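{- Let $\langle \psi_e : e\in\omega\rangle$ be a standard (acceptable) computable numbering of all partial computable functions, and let $W_e$ denote the domain of $\psi_e$. Call a nonempty computably enumerable set $A\subseteq\omega$ self-constructing if $W_e=A$ for every $e\in A$. Then for every integer $n\ge 1$ there is a self-constructing set of cardinality $n$, and there is a self-constructing set which is not computable; in fact there is a self-constructing set which is creative.
   Context: $\langle \psi_e : e\in\omega\rangle$ is a standard computable numbering of the partial computable functions (e.g. via Turing machines; any acceptable numbering in the sense of Rogers), and $W_e=\mathrm{dom}(\psi_e)$. A computably enumerable set $C$ is creative if there is a computable function $p$ such that for every $x$ with $W_x\cap C=\emptyset$ we have $p(x)\notin C\cup W_x$. -}

module Defs where

open import Data.Nat using (ℕ; zero; suc; _≤_)
open import Data.Product using (Σ; ∃; _×_; _,_; proj₁; proj₂)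
open import Data.List using (List; []; _∷_; length)
open import Data.List.Membership.Propositional using (_∈_)
open import Data.List.Relation.Unary.Unique.Propositional using (Unique)
open import Data.Maybe using (Maybe; just; nothing)
open import Data.Bool using (if_then_else_)
open import Data.Nat using (_≡ᵇ_)
open import Relation.Nullary using (¬_)
open import Relation.Binary.PropositionalEquality using (_≡_)
open import Function.Bundles using (_⇔_)

-- Base model of computation: Minsky register machines.
-- Input in register 0 (others 0), output = register 0 when the machine
-- halts (halt instruction or program counter outside the program).

-- Cantor enumeration of ℕ × ℕ (a bijection ℕ → ℕ × ℕ).
nextPair : ℕ × ℕ → ℕ × ℕ
nextPair (a , zero)  = 0 , suc a
nextPair (a , suc b) = suc a , b

unpair : ℕ → ℕ × ℕ
unpair zero    = 0 , 0
unpair (suc n) = nextPair (unpair n)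

data Instr : Set where
  inc  : ℕ → Instr
  dec  : ℕ → ℕ → Instr
  halt : Instr

decodeInstrAux : ℕ × ℕ → Instr
decodeInstrAux (zero , r)          = inc r
decodeInstrAux (suc zero , rest)   = dec (proj₁ (unpair rest)) (proj₂ (unpair rest))
decodeInstrAux (suc (suc _) , _)   = halt

decodeInstr : ℕ → Instr
decodeInstr h = decodeInstrAux (unpair h)

Program : Set
Program = List Instr

-- code 0 = [], code (suc n) = instr h ∷ code t where (h , t) = unpair n.
-- The fuel argument is ≥ the code, so it never runs out prematurely.
decodeProgF : ℕ → ℕ → Program
decodeProgF zero    _       = []
decodeProgF (suc f) zero    = []
decodeProgF (suc f) (suc n) = decodeInstr (proj₁ (unpair n)) ∷ decodeProgF f (proj₂ (unpair n))

decodeProg : ℕ → Program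
decodeProg n = decodeProgF n n

nth : {A : Set} → List A → ℕ → Maybe A
nth []       _       = nothing
nth (x ∷ xs) zero    = just x
nth (x ∷ xs) (suc n) = nth xs n

setReg : (ℕ → ℕ) → ℕ → ℕ → (ℕ → ℕ)
setReg regs r v i = if i ≡ᵇ r then v else regs i

predℕ : ℕ → ℕ
predℕ zero    = zero
predℕ (suc n) = n

run : ℕ → Program → ℕ → (ℕ → ℕ) → Maybe ℕ
run zero    p pc regs = nothing
run (suc f) p pc regs with nth p pc
... | nothing      = just (regs 0)
... | just halt    = just (regs 0)
... | just (inc r) = run f p (suc pc) (setReg regs r (suc (regs r)))
... | just (dec r j) with regs r
...    | zero   = run f p j regs
...    | suc v  = run f p (suc pc) (setReg regs r v)

initRegs : ℕ → (ℕ → ℕ)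
initRegs x zero    = x
initRegs x (suc _) = 0

Ψ₀ : ℕ → ℕ → ℕ → Set
Ψ₀ e x y = Σ ℕ λ k → run k (decodeProg e) 0 (initRegs x) ≡ just y

TotalComputable : (ℕ → ℕ) → Set
TotalComputable f = Σ ℕ λ e → ∀ x → Ψ₀ e x (f x)

-- Numberings of partial functions, given by their graphs:
-- Φ e x y  means  φ_e(x) ↓ = y.
Numbering : Set₁
Numbering = ℕ → ℕ → ℕ → Set

Acceptable : Numbering → Set
Acceptable Φ = Σ (ℕ → ℕ) λ f → Σ (ℕ → ℕ) λ g →
  TotalComputable f × TotalComputable g ×
  (∀ e x y → Φ e x y ⇔ Ψ₀ (f e) x y) ×
  (∀ e x y → Ψ₀ e x y ⇔ Φ (g e) x y)

W : Numbering → ℕ → ℕ → Set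
W Φ e x = ∃ λ y → Φ e x y

CE : Numbering → (ℕ → Set) → Set
CE Φ A = Σ ℕ λ e → ∀ x → W Φ e x ⇔ A x

SelfConstructing : Numbering → (ℕ → Set) → Set
SelfConstructing Φ A =
  (∃ λ x → A x) × CE Φ A × (∀ e → A e → ∀ x → W Φ e x ⇔ A x)

HasCardinality : (ℕ → Set) → ℕ → Set
HasCardinality A n = Σ (List ℕ) λ xs →
  length xs ≡ n × Unique xs × (∀ x → A x ⇔ x ∈ xs)

Computable : (ℕ → Set) → Set
Computable A = Σ (ℕ → ℕ) λ χ → TotalComputable χ × (∀ x → A x ⇔ χ x ≡ 1)

Creative : Numbering → (ℕ → Set) → Set
Creative Φ C = CE Φ C × Σ (ℕ → ℕ) λ p → TotalComputable p ×
  (∀ x → (∀ y → W Φ x y → ¬ C y) → ¬ C (p x) × ¬ W Φ x (p x))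

module Submission where

-- Self-constructing sets are images z ↦ g (code z) of a family of search programs
-- that know their own code, g being the translation from the reference numbering
-- into φ.  A program is a fixed prefix followed by a loader that writes its
-- parameters z and w into registers; with w the code of the reversed prefix, the
-- program can rebuild its own code, and the code of any sibling with another
-- parameter (a hand-made recursion theorem).  On input y, program z searches,
-- dovetailing over candidates z' and time bounds, for a sibling z' satisfying a
-- condition R with g (code z') = y, and then halts with output z.  Hence all the
-- indices g (code z) have the same domain A = { g (code z') | R z' }, and the
-- outputs make z ↦ g (code z) injective.  R z' = z' < n gives a set of size n; the
-- diagonal condition g (code z') ∈ W z' gives a creative set, with productive
-- function z ↦ g (code z); creative sets are not computable, since the
-- complement of a computable set is c.e.
--
-- The searches run machines step by step through a primitive recursive
-- universal step function, written in a small expression language that is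
-- compiled to LOOP programs and then to register machines.

open import Defs
open import Data.Nat using (ℕ; zero; suc; _+_; _∸_; _≤_; _<_; z≤n; s≤s; _≡ᵇ_; _<?_; _≤?_)
open import Data.Nat.Properties
open import Data.Bool using (Bool; true; false; if_then_else_; not; _∧_)
open import Data.Bool.Properties using (∧-conicalˡ; ∧-conicalʳ; not-injective)
open import Data.Empty using (⊥-elim)
open import Data.List using (List; []; _∷_; _++_; _ʳ++_; length; replicate; reverse; map; upTo)
open import Data.List.Properties using (length-++; ++-assoc; ʳ++-defn; reverse-involutive; length-map; length-upTo)
open import Data.List.Membership.Propositional using (_∈_)
open import Data.List.Membership.Propositional.Properties using (∈-map⁺; ∈-map⁻; ∈-upTo⁺; ∈-upTo⁻)
open import Data.List.Relation.Unary.All using (All; []; _∷_) renaming (map to allMap)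
import Data.List.Relation.Unary.Unique.Propositional.Properties as Unique
open import Data.Maybe using (Maybe; just; nothing)
open import Data.Maybe.Properties using (just-injective)
open import Data.Product using (Σ; ∃; _×_; _,_; proj₁; proj₂)
open import Data.Unit using (tt)
open import Function.Bundles using (_⇔_; mk⇔; Equivalence)
open import Function.Definitions using (Injective)
open import Relation.Binary.PropositionalEquality
open import Relation.Nullary using (¬_; yes; no)

-- Self-constructing images

Image : (ℕ → ℕ) → (ℕ → Set) → ℕ → Set
Image h R y = Σ ℕ λ z → R z × y ≡ h z

selfConstructing-image : ∀ {Φ} (h : ℕ → ℕ) {R : ℕ → Set} →
  (∀ z x → W Φ (h z) x ⇔ Image h R x) → ∃ R → SelfConstructing Φ (Image h R)
selfConstructing-image h domain (z , r) =
  (h z , z , r , refl) , (h z , domain z) , λ { _ (z' , _ , refl) → domain z' }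

injective-ifOutputIsIndex : ∀ {Φ} (h : ℕ → ℕ) → (∀ z x v → Φ (h z) x v → v ≡ z) →
  (∀ z → ∃ (W Φ (h z))) → Injective _≡_ _≡_ h
injective-ifOutputIsIndex {Φ} h output nonempty {a} {b} ha≡hb with nonempty a
... | x , v , φ = trans (sym (output a x v φ)) (output b x v (subst (λ e → Φ e x v) ha≡hb φ))

image-<-cardinality : (h : ℕ → ℕ) → Injective _≡_ _≡_ h → ∀ n → HasCardinality (Image h (_< n)) n
image-<-cardinality h h-inj n =
  map h (upTo n) , trans (length-map h (upTo n)) (length-upTo n) , Unique.map⁺ h-inj (Unique.upTo⁺ n) ,
  λ y → mk⇔ (λ (z , z<n , y≡hz) → subst (_∈ map h (upTo n)) (sym y≡hz) (∈-map⁺ h (∈-upTo⁺ z<n)))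
            (λ y∈ → let (z , z∈ , y≡hz) = ∈-map⁻ h y∈ in z , ∈-upTo⁻ z∈ , y≡hz)

image-diagonal-creative : ∀ {Φ} (h : ℕ → ℕ) → TotalComputable h → Injective _≡_ _≡_ h →
  CE Φ (Image h (λ z → W Φ z (h z))) → Creative Φ (Image h (λ z → W Φ z (h z)))
image-diagonal-creative {Φ} h h-computable h-inj ce = ce , h , h-computable , λ x disjoint →
  let h∉W : ¬ W Φ x (h x)
      h∉W w = disjoint (h x) w (x , w , refl)
  in (λ (z , wz , hx≡hz) → h∉W (subst (λ t → W Φ t (h t)) (sym (h-inj hx≡hz)) wz)) , h∉W

creative⇒¬ce-complement : ∀ {Φ C} → Creative Φ C → ¬ (Σ ℕ λ x → ∀ y → W Φ x y ⇔ (¬ C y))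
creative⇒¬ce-complement (_ , p , _ , productive) (x , complement) =
  let (p∉C , p∉W) = productive x (λ y w → Equivalence.to (complement y) w)
  in p∉W (Equivalence.from (complement (p x)) p∉C)

≡ᵇ-refl : ∀ x → (x ≡ᵇ x) ≡ true
≡ᵇ-refl zero = refl
≡ᵇ-refl (suc x) = ≡ᵇ-refl x

if1else0≡suc⇒true : ∀ {b m} → (if b then 1 else 0) ≡ suc m → b ≡ true
if1else0≡suc⇒true {true} _ = refl

∧-intro : ∀ {a b} → a ≡ true → b ≡ true → a ∧ b ≡ true
∧-intro refl refl = refl

≡ᵇ-sym : ∀ a b → (a ≡ᵇ b) ≡ (b ≡ᵇ a)
≡ᵇ-sym zero zero = refl
≡ᵇ-sym zero (suc b) = refl
≡ᵇ-sym (suc a) zero = refl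
≡ᵇ-sym (suc a) (suc b) = ≡ᵇ-sym a b

Distinct : ℕ → ℕ → Set
Distinct a b = (a ≡ᵇ b) ≡ false

Distinct-sym : ∀ a b → Distinct a b → Distinct b a
Distinct-sym a b h = trans (≡ᵇ-sym b a) h

≡ᵇ≡true⇒≡ : ∀ a b → (a ≡ᵇ b) ≡ true → a ≡ b
≡ᵇ≡true⇒≡ zero zero h = refl
≡ᵇ≡true⇒≡ (suc a) (suc b) h = cong suc (≡ᵇ≡true⇒≡ a b h)

≢⇒Distinct : ∀ a b → a ≢ b → Distinct a b
≢⇒Distinct a b h with a ≡ᵇ b in eq
... | true = ⊥-elim (h (≡ᵇ≡true⇒≡ a b eq))
... | false = refl

<⇒Distinct : ∀ {a b} → a < b → Distinct a b
<⇒Distinct {a} {b} h = ≢⇒Distinct a b (<⇒≢ h)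

>⇒Distinct : ∀ {a b} → b < a → Distinct a b
>⇒Distinct {a} {b} h = ≢⇒Distinct a b (>⇒≢ h)

setReg-eq : ∀ R x v → setReg R x v x ≡ v
setReg-eq R x v rewrite ≡ᵇ-refl x = refl

setReg-ne : ∀ R x v i → Distinct i x → setReg R x v i ≡ R i
setReg-ne R x v i h rewrite h = refl

notIn : ℕ → List ℕ → Bool
notIn i [] = true
notIn i (x ∷ xs) = not (i ≡ᵇ x) ∧ notIn i xs

notIn-singleton : ∀ i a → Distinct i a → notIn i (a ∷ []) ≡ true
notIn-singleton i a h rewrite h = refl

notIn-++ˡ : ∀ i xs ys → notIn i (xs ++ ys) ≡ true → notIn i xs ≡ true
notIn-++ˡ i [] ys h = refl
notIn-++ˡ i (x ∷ xs) ys h rewrite not-injective {y = false} (∧-conicalˡ (not (i ≡ᵇ x)) _ h) = notIn-++ˡ i xs ys (∧-conicalʳ (not (i ≡ᵇ x)) _ h)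

notIn-++ʳ : ∀ i xs ys → notIn i (xs ++ ys) ≡ true → notIn i ys ≡ true
notIn-++ʳ i [] ys h = h
notIn-++ʳ i (x ∷ xs) ys h = notIn-++ʳ i xs ys (∧-conicalʳ (not (i ≡ᵇ x)) _ h)

notIn-++ : ∀ i xs ys → notIn i xs ≡ true → notIn i ys ≡ true → notIn i (xs ++ ys) ≡ true
notIn-++ i [] ys h1 h2 = h2
notIn-++ i (x ∷ xs) ys h1 h2 = ∧-intro (∧-conicalˡ (not (i ≡ᵇ x)) _ h1) (notIn-++ i xs ys (∧-conicalʳ (not (i ≡ᵇ x)) _ h1) h2)

Distinct⇒not : ∀ {i a} → Distinct i a → not (i ≡ᵇ a) ≡ true
Distinct⇒not h rewrite h = refl

notIn-above : ∀ {sp i} ρl → All (_< sp) ρl → sp ≤ i → notIn i ρl ≡ true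
notIn-above [] a le = refl
notIn-above {sp} {i} (r ∷ ρl) (p ∷ a) le = ∧-intro (Distinct⇒not {i} {r} (>⇒Distinct (≤-trans p le))) (notIn-above ρl a le)

cong₃ : ∀ {A B C D : Set} (f : A → B → C → D) {a a' b b' c c'} → a ≡ a' → b ≡ b' → c ≡ c' → f a b c ≡ f a' b' c'
cong₃ f refl refl refl = refl

iter : {A : Set} → ℕ → (A → A) → A → A
iter zero f x = x
iter (suc n) f x = iter n f (f x)

iter-fix : {A : Set} (f : A → A) (s : A) → f s ≡ s → ∀ n → iter n f s ≡ s
iter-fix f s h zero = refl
iter-fix f s h (suc n) rewrite h = iter-fix f s h n

iter-cong : ∀ {A : Set} (F G : A → A) → (∀ p → F p ≡ G p) → ∀ n s → iter n F s ≡ iter n G s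
iter-cong F G h zero s = refl
iter-cong F G h (suc n) s rewrite h s = iter-cong F G h n (G s)

iter-comm : ∀ {A : Set} (F : A → A) n s → iter (suc n) F s ≡ F (iter n F s)
iter-comm F zero s = refl
iter-comm F (suc n) s = iter-comm F n (F s)

iter-suc : ∀ n v → iter n suc v ≡ n + v
iter-suc zero v = refl
iter-suc (suc n) v = trans (iter-suc n (suc v)) (+-suc n v)

sucBoth : ℕ × ℕ → ℕ × ℕ
sucBoth (x , y) = (suc x , suc y)

iter-sucBoth : ∀ n x y → iter n sucBoth (x , y) ≡ (n + x , n + y)
iter-sucBoth zero x y = refl
iter-sucBoth (suc n) x y rewrite iter-sucBoth n (suc x) (suc y) | +-suc n x | +-suc n y = refl

iter-pred : ∀ n v → iter n predℕ v ≡ v ∸ n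
iter-pred zero v = refl
iter-pred (suc n) zero = trans (iter-pred n 0) (0∸n≡0 n)
iter-pred (suc n) (suc v) = iter-pred n v

iter-const : ∀ n v → iter (suc n) (λ _ → 0) v ≡ 0
iter-const zero v = refl
iter-const (suc n) v = iter-const n 0

isZero : ℕ → ℕ
isZero zero = 1
isZero (suc _) = 0

iter-const-isZero : ∀ n → iter n (λ _ → 0) 1 ≡ isZero n
iter-const-isZero zero = refl
iter-const-isZero (suc n) = iter-const n 1

run-inc : ∀ f P pc R r → nth P pc ≡ just (inc r) →
  run (suc f) P pc R ≡ run f P (suc pc) (setReg R r (suc (R r)))
run-inc f P pc R r eq rewrite eq = refl

run-decz : ∀ f P pc R r j → nth P pc ≡ just (dec r j) → R r ≡ 0 →
  run (suc f) P pc R ≡ run f P j R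
run-decz f P pc R r j eq e rewrite eq | e = refl

run-decs : ∀ f P pc R r j v → nth P pc ≡ just (dec r j) → R r ≡ suc v →
  run (suc f) P pc R ≡ run f P (suc pc) (setReg R r v)
run-decs f P pc R r j v eq e rewrite eq | e = refl

run-halt : ∀ f P pc R → nth P pc ≡ just halt → run (suc f) P pc R ≡ just (R 0)
run-halt f P pc R eq rewrite eq = refl

run-mono : ∀ k P pc R y → run k P pc R ≡ just y → run (suc k) P pc R ≡ just y
run-mono zero P pc R y ()
run-mono (suc k) P pc R y h with nth P pc
... | nothing = h
... | just halt = h
... | just (inc r) = run-mono k P (suc pc) _ y h
... | just (dec r j) with R r
...    | zero = run-mono k P j R y h
...    | suc v = run-mono k P (suc pc) _ y h

run-mono+ : ∀ m k P pc R y → run k P pc R ≡ just y → run (m + k) P pc R ≡ just y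
run-mono+ zero k P pc R y h = h
run-mono+ (suc m) k P pc R y h = run-mono (m + k) P pc R y (run-mono+ m k P pc R y h)

run-mono≤ : ∀ {k k'} P pc R y → k ≤ k' → run k P pc R ≡ just y → run k' P pc R ≡ just y
run-mono≤ {k} {k'} P pc R y le h =
  subst (λ t → run t P pc R ≡ just y) (m∸n+n≡m le) (run-mono+ (k' ∸ k) k P pc R y h)

run-deterministic : ∀ {a b P pc R y y'} → run a P pc R ≡ just y → run b P pc R ≡ just y' → y ≡ y'
run-deterministic {a} {b} {P} {pc} {R} {y} {y'} h h' =
  just-injective (trans (sym (run-mono≤ P pc R y (m≤m+n a b) h)) (run-mono≤ P pc R y' (m≤n+m b a) h'))

Reach : Program → ℕ → (ℕ → ℕ) → ℕ → (ℕ → ℕ) → Set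
Reach P a R b S = Σ ℕ λ k → ∀ f → run (k + f) P a R ≡ run f P b S

reach-trans : ∀ {P a R b S c U} → Reach P a R b S → Reach P b S c U → Reach P a R c U
reach-trans {P} {a} {R} (k1 , h1) (k2 , h2) =
  k1 + k2 , λ f → trans (cong (λ t → run t P a R) (+-assoc k1 k2 f)) (trans (h1 (k2 + f)) (h2 f))

reach-step : ∀ {P a R b S} → (∀ f → run (suc f) P a R ≡ run f P b S) → Reach P a R b S
reach-step h = 1 , h

record Contains (P : Program) (i : ℕ) (xs : List Instr) : Set where
  constructor mkC
  field get : ∀ m x → nth xs m ≡ just x → nth P (i + m) ≡ just x
open Contains

nth-++ˡ : ∀ (xs ys : List Instr) m x → nth xs m ≡ just x → nth (xs ++ ys) m ≡ just x
nth-++ˡ [] ys m x ()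
nth-++ˡ (a ∷ xs) ys zero x h = h
nth-++ˡ (a ∷ xs) ys (suc m) x h = nth-++ˡ xs ys m x h

nth-++ʳ : ∀ (xs ys : List Instr) m x → nth ys m ≡ just x → nth (xs ++ ys) (length xs + m) ≡ just x
nth-++ʳ [] ys m x h = h
nth-++ʳ (a ∷ xs) ys m x h = nth-++ʳ xs ys m x h

contains-++ˡ : ∀ {P i} xs ys → Contains P i (xs ++ ys) → Contains P i xs
contains-++ˡ xs ys c = mkC λ m x h → get c m x (nth-++ˡ xs ys m x h)

contains-++ʳ : ∀ {P i} xs ys → Contains P i (xs ++ ys) → Contains P (i + length xs) ys
contains-++ʳ {P} {i} xs ys c = mkC λ m x h →
  subst (λ t → nth P t ≡ just x) (sym (+-assoc i (length xs) m)) (get c (length xs + m) x (nth-++ʳ xs ys m x h))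

contains-hd : ∀ {P i} x xs → Contains P i (x ∷ xs) → nth P i ≡ just x
contains-hd {P} {i} x xs c = subst (λ t → nth P t ≡ just x) (+-identityʳ i) (get c 0 x refl)

contains-tl : ∀ {P i} x xs → Contains P i (x ∷ xs) → Contains P (suc i) xs
contains-tl {P} {i} x xs c = mkC λ m y h → subst (λ t → nth P t ≡ just y) (+-suc i m) (get c (suc m) y h)

-- LOOP programs and their compilation

data LoopProg : Set where
  skip : LoopProg
  INC  : ℕ → LoopProg
  DEC  : ℕ → LoopProg
  _⨾_  : LoopProg → LoopProg → LoopProg
  LOOP : ℕ → LoopProg → LoopProg
  INCS : ℕ → ℕ → LoopProg

infixr 4 _⨾_

incReg : (ℕ → ℕ) → ℕ → (ℕ → ℕ)
incReg R r = setReg R r (suc (R r))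

decReg : (ℕ → ℕ) → ℕ → ℕ → (ℕ → ℕ)
decReg R r zero = R
decReg R r (suc v) = setReg R r v

addReg : ℕ → ℕ → (ℕ → ℕ) → (ℕ → ℕ)
addReg r zero R = R
addReg r (suc c) R = addReg r c (incReg R r)

run-decE : ∀ f P pc R r → nth P pc ≡ just (dec r (suc pc)) →
  run (suc f) P pc R ≡ run f P (suc pc) (decReg R r (R r))
run-decE f P pc R r eq rewrite eq with R r
... | zero = refl
... | suc v = refl

-- LOOP x b runs b (R x) times, setting x to the number of rounds still to come.
mutual
  eval : LoopProg → (ℕ → ℕ) → (ℕ → ℕ)
  eval skip R = R
  eval (INC r) R = incReg R r
  eval (DEC r) R = decReg R r (R r)
  eval (p ⨾ q) R = eval q (eval p R)
  eval (LOOP x b) R = iterLoop x b (R x) R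
  eval (INCS r c) R = addReg r c R

  iterLoop : ℕ → LoopProg → ℕ → (ℕ → ℕ) → (ℕ → ℕ)
  iterLoop x b zero R = R
  iterLoop x b (suc n) R = iterLoop x b n (eval b (setReg R x n))

writes : LoopProg → List ℕ
writes skip = []
writes (INC r) = r ∷ []
writes (DEC r) = r ∷ []
writes (p ⨾ q) = writes p ++ writes q
writes (LOOP x b) = x ∷ writes b
writes (INCS r c) = r ∷ []

wf : LoopProg → Bool
wf (p ⨾ q) = wf p ∧ wf q
wf (LOOP x b) = notIn x (writes b) ∧ wf b
wf _ = true

eval-frame : ∀ p R i → notIn i (writes p) ≡ true → eval p R i ≡ R i
iterLoop-frame : ∀ x b n R i → notIn i (x ∷ writes b) ≡ true → iterLoop x b n R i ≡ R i
addReg-frame : ∀ r c R i → Distinct i r → addReg r c R i ≡ R i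

eval-frame skip R i h = refl
eval-frame (INC r) R i h = setReg-ne R r _ i (not-injective {y = false} (∧-conicalˡ (not (i ≡ᵇ r)) _ h))
eval-frame (DEC r) R i h with R r
... | zero = refl
... | suc v = setReg-ne R r v i (not-injective {y = false} (∧-conicalˡ (not (i ≡ᵇ r)) _ h))
eval-frame (p ⨾ q) R i h =
  trans (eval-frame q (eval p R) i (notIn-++ʳ i (writes p) _ h)) (eval-frame p R i (notIn-++ˡ i (writes p) _ h))
eval-frame (LOOP x b) R i h = iterLoop-frame x b (R x) R i h
eval-frame (INCS r c) R i h = addReg-frame r c R i (not-injective {y = false} (∧-conicalˡ (not (i ≡ᵇ r)) _ h))

iterLoop-frame x b zero R i h = refl
iterLoop-frame x b (suc n) R i h =
  trans (iterLoop-frame x b n _ i h)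
    (trans (eval-frame b _ i (∧-conicalʳ (not (i ≡ᵇ x)) _ h)) (setReg-ne R x n i (not-injective {y = false} (∧-conicalˡ (not (i ≡ᵇ x)) _ h))))

addReg-frame r zero R i h = refl
addReg-frame r (suc c) R i h = trans (addReg-frame r c _ i h) (setReg-ne R r _ i h)

notIn-⨾ : ∀ i p q → notIn i (writes p) ≡ true → notIn i (writes q) ≡ true → notIn i (writes (p ⨾ q)) ≡ true
notIn-⨾ i p q = notIn-++ i (writes p) (writes q)

notIn-LOOP : ∀ i x b → Distinct i x → notIn i (writes b) ≡ true → notIn i (writes (LOOP x b)) ≡ true
notIn-LOOP i x b i≢x h rewrite i≢x = h

wf-⨾ : ∀ {p q} → wf p ≡ true → wf q ≡ true → wf (p ⨾ q) ≡ true
wf-⨾ = ∧-intro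

wf-LOOP : ∀ {x b} → notIn x (writes b) ≡ true → wf b ≡ true → wf (LOOP x b) ≡ true
wf-LOOP = ∧-intro

size : LoopProg → ℕ
size skip = 0
size (INC r) = 1
size (DEC r) = 1
size (p ⨾ q) = size p + size q
size (LOOP x b) = suc (suc (size b))
size (INCS r c) = c

-- Compiled code is placed at address i.  Register 1 is never written by the
-- programs we compile and stays 0, so dec 1 j is an unconditional jump.
compile : ℕ → LoopProg → List Instr
compile i skip = []
compile i (INC r) = inc r ∷ []
compile i (DEC r) = dec r (suc i) ∷ []
compile i (p ⨾ q) = compile i p ++ compile (i + size p) q
compile i (LOOP x b) = dec x (i + suc (suc (size b))) ∷ (compile (suc i) b ++ dec 1 i ∷ [])
compile i (INCS r c) = replicate c (inc r)

length-compile : ∀ i p → length (compile i p) ≡ size p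
length-compile i skip = refl
length-compile i (INC r) = refl
length-compile i (DEC r) = refl
length-compile i (p ⨾ q) = trans (length-++ (compile i p)) (cong₂ _+_ (length-compile i p) (length-compile _ q))
length-compile i (LOOP x b) = cong suc (trans (length-++ (compile (suc i) b))
   (trans (cong (_+ 1) (length-compile (suc i) b)) (+-comm (size b) 1)))
length-compile i (INCS r zero) = refl
length-compile i (INCS r (suc c)) = cong suc (length-compile i (INCS r c))

compile-correct : ∀ p P i → Contains P i (compile i p) → wf p ≡ true → ∀ R → R 1 ≡ 0 →
  notIn 1 (writes p) ≡ true → Reach P i R (i + size p) (eval p R)
compile-correct skip P i c w R z keeps1 = 0 , λ f → cong (λ t → run f P t R) (sym (+-identityʳ i))
compile-correct (INC r) P i c w R z keeps1 = 1 , λ f →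
  trans (run-inc f P i R r (contains-hd _ [] c)) (cong (λ t → run f P t (incReg R r)) (sym (+-comm i 1)))
compile-correct (DEC r) P i c w R z keeps1 = 1 , λ f →
  trans (run-decE f P i R r (contains-hd _ [] c)) (cong (λ t → run f P t (eval (DEC r) R)) (sym (+-comm i 1)))
compile-correct (p ⨾ q) P i c w R z keeps1 =
  reach-trans (compile-correct p P i cp (∧-conicalˡ (wf p) _ w) R z n1p)
   (subst (λ t → Reach P (i + size p) (eval p R) t (eval q (eval p R))) (+-assoc i (size p) (size q))
     (compile-correct q P (i + size p) cq (∧-conicalʳ (wf p) _ w) (eval p R) (trans (eval-frame p R 1 n1p) z) n1q))
  where
  n1p = notIn-++ˡ 1 (writes p) _ keeps1
  n1q = notIn-++ʳ 1 (writes p) _ keeps1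
  cp = contains-++ˡ (compile i p) _ c
  cq : Contains P (i + size p) (compile (i + size p) q)
  cq = subst (λ t → Contains P (i + t) (compile (i + size p) q)) (length-compile i p) (contains-++ʳ (compile i p) _ c)
compile-correct (LOOP x b) P i c w R z keeps1 = loop-reaches (R x) R refl z
  where
  wb = ∧-conicalʳ (notIn x (writes b)) _ w
  nxb = ∧-conicalˡ (notIn x (writes b)) _ w
  n1b = ∧-conicalʳ (not (1 ≡ᵇ x)) _ keeps1
  n1x = not-injective {y = false} (∧-conicalˡ (not (1 ≡ᵇ x)) _ keeps1)
  ctl = contains-tl _ _ c
  cb : Contains P (suc i) (compile (suc i) b)
  cb = contains-++ˡ (compile (suc i) b) _ ctl
  cg : nth P (suc i + size b) ≡ just (dec 1 i)
  cg = subst (λ t → nth P (suc i + t) ≡ just (dec 1 i)) (length-compile (suc i) b)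
         (contains-hd _ [] (contains-++ʳ (compile (suc i) b) _ ctl))
  chd = contains-hd _ _ c
  loop-reaches : ∀ n S → S x ≡ n → S 1 ≡ 0 → Reach P i S (i + suc (suc (size b))) (iterLoop x b n S)
  loop-reaches zero S e z' = 1 , λ f → run-decz f P i S x _ chd e
  loop-reaches (suc n) S e z' =
    reach-trans (reach-step (λ f → run-decs f P i S x _ n chd e))
     (reach-trans (compile-correct b P (suc i) cb wb S' z1 n1b)
       (reach-trans (reach-step {S = S''} (λ f → run-decz f P (suc i + size b) S'' 1 i cg
            (trans (eval-frame b S' 1 n1b) z1)))
         (loop-reaches n S'' (trans (eval-frame b S' x nxb) (setReg-eq S x n)) (trans (eval-frame b S' 1 n1b) z1))))
    where
    S' = setReg S x n
    S'' = eval b S'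
    z1 : S' 1 ≡ 0
    z1 = trans (setReg-ne S x n 1 n1x) z'
compile-correct (INCS r c) P i cc w R z keeps1 = increments c i R cc
  where
  increments : ∀ c j S → Contains P j (replicate c (inc r)) → Reach P j S (j + c) (addReg r c S)
  increments zero j S _ = 0 , λ f → cong (λ t → run f P t S) (sym (+-identityʳ j))
  increments (suc c) j S cc' = reach-trans (reach-step (λ f → run-inc f P j S r (contains-hd _ _ cc')))
     (subst (λ t → Reach P (suc j) (incReg S r) t (addReg r c (incReg S r))) (sym (+-suc j c))
       (increments c (suc j) (incReg S r) (contains-tl _ _ cc')))

iterLoop-view : ∀ {A : Set} (V : (ℕ → ℕ) → A) (F : A → A) x b →
  (∀ S m → V (setReg S x m) ≡ V S) → (∀ S → V (eval b S) ≡ F (V S)) →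
  ∀ n S → V (iterLoop x b n S) ≡ iter n F (V S)
iterLoop-view V F x b hs hb zero S = refl
iterLoop-view V F x b hs hb (suc n) S =
  trans (iterLoop-view V F x b hs hb n _) (cong (iter n F) (trans (hb _) (cong F (hs S n))))

iterLoop-counter : ∀ x b → notIn x (writes b) ≡ true → ∀ n S → S x ≡ n → iterLoop x b n S x ≡ 0
iterLoop-counter x b h zero S e = e
iterLoop-counter x b h (suc n) S e = iterLoop-counter x b h n _ (trans (eval-frame b _ x h) (setReg-eq S x n))

iterLoop-invariant : ∀ {A : Set} (I : (ℕ → ℕ) → Set) (V : (ℕ → ℕ) → A) (F : A → A) x b →
  (∀ S m → I S → I (setReg S x m)) → (∀ S → I S → I (eval b S)) →
  (∀ S m → V (setReg S x m) ≡ V S) → (∀ S → I S → V (eval b S) ≡ F (V S)) →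
  ∀ n S → I S → (V (iterLoop x b n S) ≡ iter n F (V S)) × I (iterLoop x b n S)
iterLoop-invariant I V F x b i1 i2 hs hb zero S iS = refl , iS
iterLoop-invariant I V F x b i1 i2 hs hb (suc n) S iS with iterLoop-invariant I V F x b i1 i2 hs hb n (eval b (setReg S x n)) (i2 _ (i1 S n iS))
... | e , iS' = trans e (cong (iter n F) (trans (hb _ (i1 S n iS)) (cong F (hs S n)))) , iS'

iterLoop-preserves : ∀ x b i → Distinct i x → (∀ S → eval b S i ≡ S i) → ∀ n S → iterLoop x b n S i ≡ S i
iterLoop-preserves x b i h hb zero S = refl
iterLoop-preserves x b i h hb (suc n) S = trans (iterLoop-preserves x b i h hb n _) (trans (hb _) (setReg-ne S x n i h))

iterLoop-once : ∀ x b S → S x ≡ 1 → ∀ i → iterLoop x b (S x) S i ≡ eval b (setReg S x 0) i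
iterLoop-once x b S e i rewrite e = refl

iterLoop-never : ∀ x b S → S x ≡ 0 → ∀ i → iterLoop x b (S x) S i ≡ S i
iterLoop-never x b S e i rewrite e = refl

addReg-value : ∀ r c R → addReg r c R r ≡ c + R r
addReg-value r zero R = refl
addReg-value r (suc c) R = trans (addReg-value r c (incReg R r)) (trans (cong (c +_) (setReg-eq R r (suc (R r)))) (+-suc c (R r)))

DEC-value : ∀ r R → eval (DEC r) R r ≡ predℕ (R r)
DEC-value r R with R r in e
... | zero = e
... | suc v = setReg-eq R r v

DEC-frame : ∀ r S i → Distinct i r → eval (DEC r) S i ≡ S i
DEC-frame r S i h = eval-frame (DEC r) S i (notIn-singleton i r h)

CLR : ℕ → LoopProg
CLR a = LOOP a skip

CLR-clears : ∀ a R → eval (CLR a) R a ≡ 0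
CLR-clears a R = iterLoop-counter a skip refl (R a) R refl

MOV : ℕ → ℕ → LoopProg
MOV a b = LOOP a (INC b)

MOV-adds : ∀ a b → Distinct a b → ∀ R → eval (MOV a b) R b ≡ R a + R b
MOV-adds a b h R = trans (iterLoop-view (λ S → S b) suc a (INC b)
    (λ S m → setReg-ne S a m b (Distinct-sym a b h)) (λ S → setReg-eq S b (suc (S b))) (R a) R) (iter-suc (R a) (R b))

COPY : ℕ → ℕ → ℕ → LoopProg
COPY a b t = CLR b ⨾ CLR t ⨾ LOOP a (INC b ⨾ INC t) ⨾ MOV t a

module COPY-correct (a b t : ℕ) (ab : Distinct a b) (at : Distinct a t) (bt : Distinct b t) (R : ℕ → ℕ) where
  R1 R2 R3 R4 : ℕ → ℕ
  R1 = eval (CLR b) R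
  R2 = eval (CLR t) R1
  R3 = eval (LOOP a (INC b ⨾ INC t)) R2
  R4 = eval (MOV t a) R3
  ba : Distinct b a
  ba = Distinct-sym a b ab
  ta : Distinct t a
  ta = Distinct-sym a t at
  r2a : R2 a ≡ R a
  r2a = trans (eval-frame (CLR t) R1 a (notIn-singleton a t at)) (eval-frame (CLR b) R a (notIn-singleton a b ab))
  r2b : R2 b ≡ 0
  r2b = trans (eval-frame (CLR t) R1 b (notIn-singleton b t bt)) (CLR-clears b R)
  r2t : R2 t ≡ 0
  r2t = CLR-clears t R1
  v3 : (R3 b , R3 t) ≡ (R a + 0 , R a + 0)
  v3 = trans (iterLoop-view (λ S → (S b , S t)) sucBoth a (INC b ⨾ INC t)
         (λ S m → cong₂ _,_ (setReg-ne S a m b ba) (setReg-ne S a m t ta))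
         (λ S → cong₂ _,_ (trans (setReg-ne (incReg S b) t _ b bt) (setReg-eq S b (suc (S b))))
                          (trans (setReg-eq (incReg S b) t _) (cong suc (setReg-ne S b (suc (S b)) t (Distinct-sym b t bt)))))
         (R2 a) R2)
       (trans (cong (iter (R2 a) sucBoth) (cong₂ _,_ r2b r2t))
              (trans (iter-sucBoth (R2 a) 0 0) (cong (λ z → (z + 0 , z + 0)) r2a)))
  r3a : R3 a ≡ 0
  r3a = iterLoop-counter a (INC b ⨾ INC t) (trans (cong (_∧ _) (cong not ab)) (cong (λ z → not z ∧ true) at)) (R2 a) R2 refl
  source-kept : eval (COPY a b t) R a ≡ R a
  source-kept = trans (MOV-adds t a ta R3) (trans (cong₂ _+_ (cong proj₂ v3) r3a) (trans (+-identityʳ _) (+-identityʳ _)))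
  target-copied : eval (COPY a b t) R b ≡ R a
  target-copied = trans (eval-frame (MOV t a) R3 b (trans (cong (λ z → not z ∧ (not (b ≡ᵇ a) ∧ true)) bt) (cong (λ z → not z ∧ true) ba)))
          (trans (cong proj₁ v3) (+-identityʳ _))

CLR-frame : ∀ a R i → Distinct i a → eval (CLR a) R i ≡ R i
CLR-frame a R i h = eval-frame (CLR a) R i (notIn-singleton i a h)

MOV-frame : ∀ a b R i → Distinct i a → Distinct i b → eval (MOV a b) R i ≡ R i
MOV-frame a b R i h1 h2 = eval-frame (MOV a b) R i (subst (λ z → not z ∧ (not (i ≡ᵇ b) ∧ true) ≡ true) (sym h1) (notIn-singleton i b h2))

COPY-frame : ∀ a b t R i → Distinct i a → Distinct i b → Distinct i t → eval (COPY a b t) R i ≡ R i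
COPY-frame a b t R i ha hb ht = eval-frame (COPY a b t) R i (lem)
  where
  lem : notIn i (writes (COPY a b t)) ≡ true
  lem rewrite ha | hb | ht = refl

triangle : ℕ → ℕ
triangle zero = 0
triangle (suc s) = triangle s + suc s

pair : ℕ → ℕ → ℕ
pair a b = triangle (a + b) + a

unpair-triangle : ∀ s a → a ≤ s → unpair (triangle s + a) ≡ (a , s ∸ a)
unpair-triangle zero zero h = refl
unpair-triangle (suc s) zero h
  rewrite +-identityʳ (triangle s + suc s) | +-suc (triangle s) s | unpair-triangle s s ≤-refl | n∸n≡0 s = refl
unpair-triangle s (suc a) h rewrite +-suc (triangle s) a | unpair-triangle s a (<⇒≤ h) | +-∸-assoc 1 h = refl

unpair-pair : ∀ a b → unpair (pair a b) ≡ (a , b)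
unpair-pair a b rewrite unpair-triangle (a + b) a (m≤m+n a b) | m+n∸m≡n a b = refl

n≤triangle : ∀ s → s ≤ triangle s
n≤triangle zero = z≤n
n≤triangle (suc s) = m≤n+m (suc s) (triangle s)

pair-≥ʳ : ∀ a b → b ≤ pair a b
pair-≥ʳ a b = ≤-trans (m≤n+m b a) (≤-trans (n≤triangle (a + b)) (m≤m+n (triangle (a + b)) a))

unpair-≤₂ : ∀ n → proj₂ (unpair n) ≤ n
unpair-≤₁ : ∀ n → proj₁ (unpair n) ≤ n
unpair-≤₂ zero = z≤n
unpair-≤₂ (suc n) with unpair n | unpair-≤₁ n | unpair-≤₂ n
... | (a , zero) | h1 | h2 = s≤s h1
... | (a , suc b) | h1 | h2 = ≤-trans (n≤1+n b) (≤-trans h2 (n≤1+n n))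
unpair-≤₁ zero = z≤n
unpair-≤₁ (suc n) with unpair n | unpair-≤₁ n | unpair-≤₂ n
... | (a , zero) | h1 | h2 = z≤n
... | (a , suc b) | h1 | h2 = s≤s h1

codeInstr : Instr → ℕ
codeInstr (inc r) = pair 0 r
codeInstr (dec r j) = pair 1 (pair r j)
codeInstr halt = pair 2 0

decodeInstr-codeInstr : ∀ i → decodeInstr (codeInstr i) ≡ i
decodeInstr-codeInstr (inc r) rewrite unpair-pair 0 r = refl
decodeInstr-codeInstr (dec r j) rewrite unpair-pair 1 (pair r j) | unpair-pair r j = refl
decodeInstr-codeInstr halt rewrite unpair-pair 2 0 = refl

opaque
  codeProg : Program → ℕ
  codeProg [] = 0
  codeProg (i ∷ p) = suc (pair (codeInstr i) (codeProg p))

  codeProg-[] : codeProg [] ≡ 0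
  codeProg-[] = refl

  codeProg-∷ : ∀ i p → codeProg (i ∷ p) ≡ suc (pair (codeInstr i) (codeProg p))
  codeProg-∷ i p = refl

  decodeProgF-codeProg : ∀ p f → codeProg p ≤ f → decodeProgF f (codeProg p) ≡ p
  decodeProgF-codeProg [] zero h = refl
  decodeProgF-codeProg [] (suc f) h = refl
  decodeProgF-codeProg (i ∷ p) (suc f) (s≤s h)
    rewrite unpair-pair (codeInstr i) (codeProg p) | decodeInstr-codeInstr i
    = cong (i ∷_) (decodeProgF-codeProg p f (≤-trans (pair-≥ʳ (codeInstr i) (codeProg p)) h))

  decodeProg-codeProg : ∀ p → decodeProg (codeProg p) ≡ p
  decodeProg-codeProg p = decodeProgF-codeProg p (codeProg p) ≤-refl

-- A primitive recursive universal step

tailCode : ℕ → ℕ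
tailCode c = proj₂ (unpair (predℕ c))

dropCode : ℕ → ℕ → ℕ
dropCode zero c = c
dropCode (suc n) c = dropCode n (tailCode c)

headInstr : ℕ → Maybe Instr
headInstr zero = nothing
headInstr (suc m) = just (decodeInstr (proj₁ (unpair m)))

lookupCode : ℕ → ℕ → Maybe Instr
lookupCode e pc = headInstr (dropCode pc e)

dropCode-0 : ∀ n → dropCode n 0 ≡ 0
dropCode-0 zero = refl
dropCode-0 (suc n) = dropCode-0 n

nth-decodeProgF : ∀ f c pc → c ≤ f → nth (decodeProgF f c) pc ≡ lookupCode c pc
nth-decodeProgF zero zero pc h rewrite dropCode-0 pc = refl
nth-decodeProgF (suc f) zero pc h rewrite dropCode-0 pc = refl
nth-decodeProgF (suc f) (suc m) zero h = refl
nth-decodeProgF (suc f) (suc m) (suc pc) (s≤s h) = nth-decodeProgF f _ pc (≤-trans (unpair-≤₂ m) h)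

nth-decodeProg : ∀ e pc → nth (decodeProg e) pc ≡ lookupCode e pc
nth-decodeProg e pc = nth-decodeProgF e e pc ≤-refl

-- Register files are coded as association lists, the newest entry first.
consReg : ℕ → ℕ → ℕ → ℕ
consReg r v L = suc (pair (pair r v) L)

-- A state is (pair pc regs , 0) while running and (_ , suc y) after halting with output y.
UState : Set
UState = ℕ × ℕ

lookupStep : ℕ → UState → UState
lookupStep r (zero , fv) = (zero , fv)
lookupStep r (suc m , suc fv) = (suc m , suc fv)
lookupStep r (suc m , zero) =
  (proj₂ (unpair m) , (if r ≡ᵇ proj₁ (unpair (proj₁ (unpair m))) then suc (proj₂ (unpair (proj₁ (unpair m)))) else 0))

lookupReg : ℕ → ℕ → ℕ
lookupReg L r = predℕ (proj₂ (iter L (lookupStep r) (L , 0)))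

lookupStep-found : ∀ r t v → lookupStep r (t , suc v) ≡ (t , suc v)
lookupStep-found r zero v = refl
lookupStep-found r (suc t) v = refl

lookupReg-stable : ∀ r n m c → c ≤ n → c ≤ m →
  proj₂ (iter n (lookupStep r) (c , 0)) ≡ proj₂ (iter m (lookupStep r) (c , 0))
lookupReg-stable r n m zero h1 h2 rewrite iter-fix (lookupStep r) (0 , 0) refl n | iter-fix (lookupStep r) (0 , 0) refl m = refl
lookupReg-stable r (suc n) (suc m) (suc c) (s≤s h1) (s≤s h2) with r ≡ᵇ proj₁ (unpair (proj₁ (unpair c)))
... | true rewrite iter-fix (lookupStep r) _ (lookupStep-found r (proj₂ (unpair c)) (proj₂ (unpair (proj₁ (unpair c))))) n
                | iter-fix (lookupStep r) _ (lookupStep-found r (proj₂ (unpair c)) (proj₂ (unpair (proj₁ (unpair c))))) m = refl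
... | false = lookupReg-stable r n m (proj₂ (unpair c)) (≤-trans (unpair-≤₂ c) h1) (≤-trans (unpair-≤₂ c) h2)

lookupReg-cons : ∀ r v L i → lookupReg (consReg r v L) i ≡ (if i ≡ᵇ r then v else lookupReg L i)
lookupReg-cons r v L i rewrite unpair-pair (pair r v) L | unpair-pair r v with i ≡ᵇ r
... | true = cong (λ p → predℕ (proj₂ p)) (iter-fix (lookupStep i) (L , suc v) (lookupStep-found i L v) (pair (pair r v) L))
... | false = cong predℕ (lookupReg-stable i (pair (pair r v) L) L L (pair-≥ʳ (pair r v) L) ≤-refl)

pcOf : ℕ → ℕ
pcOf s = proj₁ (unpair s)
regsOf : ℕ → ℕ
regsOf s = proj₂ (unpair s)

stepInstr : Maybe Instr → ℕ → UState
stepInstr nothing s = (s , suc (lookupReg (regsOf s) 0))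
stepInstr (just halt) s = (s , suc (lookupReg (regsOf s) 0))
stepInstr (just (inc r)) s = (pair (suc (pcOf s)) (consReg r (suc (lookupReg (regsOf s) r)) (regsOf s)) , 0)
stepInstr (just (dec r j)) s with lookupReg (regsOf s) r
... | zero = (pair j (regsOf s) , 0)
... | suc v = (pair (suc (pcOf s)) (consReg r v (regsOf s)) , 0)

ustep : ℕ → UState → UState
ustep e (s , zero) = stepInstr (lookupCode e (pcOf s)) s
ustep e (s , suc d) = (s , suc d)

uresult : UState → Maybe ℕ
uresult (s , zero) = nothing
uresult (s , suc o) = just o

initRegsCode : ℕ → ℕ
initRegsCode x = consReg 0 x 0

urun : ℕ → ℕ → ℕ → UState
urun e x k = iter k (ustep e) (pair 0 (initRegsCode x) , 0)

Represents : (ℕ → ℕ) → ℕ → Set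
Represents R L = ∀ i → R i ≡ lookupReg L i

represents-cons : ∀ {R L} r v → Represents R L → Represents (setReg R r v) (consReg r v L)
represents-cons {R} {L} r v rep i rewrite lookupReg-cons r v L i with i ≡ᵇ r
... | true = refl
... | false = rep i

run-simulated : ∀ e k s R → Represents R (regsOf s) →
  run k (decodeProg e) (pcOf s) R ≡ uresult (iter k (ustep e) (s , 0))
run-simulated-pair : ∀ e k pc L R → Represents R L →
  run k (decodeProg e) pc R ≡ uresult (iter k (ustep e) (pair pc L , 0))

run-simulated e zero s R rep = refl
run-simulated e (suc k) s R rep rewrite nth-decodeProg e (pcOf s) with lookupCode e (pcOf s)
... | nothing rewrite iter-fix (ustep e) (s , suc (lookupReg (regsOf s) 0)) refl k = cong just (rep 0)
... | just halt rewrite iter-fix (ustep e) (s , suc (lookupReg (regsOf s) 0)) refl k = cong just (rep 0)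
... | just (inc r) rewrite rep r = run-simulated-pair e k (suc (pcOf s)) _ _ (represents-cons r _ rep)
... | just (dec r j) rewrite rep r with lookupReg (regsOf s) r
...   | zero = run-simulated-pair e k j (regsOf s) R rep
...   | suc v = run-simulated-pair e k (suc (pcOf s)) _ _ (represents-cons r v rep)

run-simulated-pair e k pc L R rep =
  subst (λ t → run k (decodeProg e) t R ≡ uresult (iter k (ustep e) (pair pc L , 0))) (cong proj₁ (unpair-pair pc L))
    (run-simulated e k (pair pc L) R (subst (Represents R) (sym (cong proj₂ (unpair-pair pc L))) rep))

initRegs-represented : ∀ x → Represents (initRegs x) (initRegsCode x)
initRegs-represented x i rewrite lookupReg-cons 0 x 0 i with i
... | zero = refl
... | suc _ = refl

run≡urun : ∀ e x k → run k (decodeProg e) 0 (initRegs x) ≡ uresult (urun e x k)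
run≡urun e x k = run-simulated-pair e k 0 (initRegsCode x) (initRegs x) (initRegs-represented x)

-- Code 0 is the empty program, which halts at once with its input as output.
Ψ₀-empty : ∀ x → Ψ₀ 0 x x
Ψ₀-empty x = 1 , refl

Ψ₀-functional : ∀ {e x y y'} → Ψ₀ e x y → Ψ₀ e x y' → y ≡ y'
Ψ₀-functional {e} {x} (k , h) (k' , h') = run-deterministic {k} {k'} {decodeProg e} {0} {initRegs x} h h'

-- Expressions and their compilation

data Expr : Set where
  var  : ℕ → Expr
  lit  : ℕ → Expr
  sucE : Expr → Expr
  predE : Expr → Expr
  addE : Expr → Expr → Expr
  subE : Expr → Expr → Expr
  ifz  : Expr → Expr → Expr → Expr
  it   : Bool → Expr → Expr → Expr → Expr → Expr → Expr

extend : ℕ → ℕ → (ℕ → ℕ) → ℕ → ℕ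
extend x y ρ zero = x
extend x y ρ (suc zero) = y
extend x y ρ (suc (suc i)) = ρ i

ifZero : ℕ → ℕ → ℕ → ℕ
ifZero zero a b = a
ifZero (suc _) a b = b

select : {A : Set} → Bool → A × A → A
select true p = proj₁ p
select false p = proj₂ p

⟦_⟧ : Expr → (ℕ → ℕ) → ℕ
⟦ var i ⟧ ρ = ρ i
⟦ lit c ⟧ ρ = c
⟦ sucE e ⟧ ρ = suc (⟦ e ⟧ ρ)
⟦ predE e ⟧ ρ = predℕ (⟦ e ⟧ ρ)
⟦ addE a b ⟧ ρ = ⟦ a ⟧ ρ + ⟦ b ⟧ ρ
⟦ subE a b ⟧ ρ = ⟦ a ⟧ ρ ∸ ⟦ b ⟧ ρ
⟦ ifz c a b ⟧ ρ = ifZero (⟦ c ⟧ ρ) (⟦ a ⟧ ρ) (⟦ b ⟧ ρ)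
⟦ it s n a b f g ⟧ ρ = select s (iter (⟦ n ⟧ ρ) (λ p → (⟦ f ⟧ (extend (proj₁ p) (proj₂ p) ρ) , ⟦ g ⟧ (extend (proj₁ p) (proj₂ p) ρ))) (⟦ a ⟧ ρ , ⟦ b ⟧ ρ))

exprStep : Expr → Expr → (ℕ → ℕ) → ℕ × ℕ → ℕ × ℕ
exprStep f g ρ p = (⟦ f ⟧ (extend (proj₁ p) (proj₂ p) ρ) , ⟦ g ⟧ (extend (proj₁ p) (proj₂ p) ρ))

extend-cong : ∀ x y ρ σ → (∀ i → ρ i ≡ σ i) → ∀ i → extend x y ρ i ≡ extend x y σ i
extend-cong x y ρ σ h zero = refl
extend-cong x y ρ σ h (suc zero) = refl
extend-cong x y ρ σ h (suc (suc i)) = h i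

⟦⟧-cong : ∀ e ρ σ → (∀ i → ρ i ≡ σ i) → ⟦ e ⟧ ρ ≡ ⟦ e ⟧ σ
⟦⟧-cong (var i) ρ σ h = h i
⟦⟧-cong (lit c) ρ σ h = refl
⟦⟧-cong (sucE e) ρ σ h = cong suc (⟦⟧-cong e ρ σ h)
⟦⟧-cong (predE e) ρ σ h = cong predℕ (⟦⟧-cong e ρ σ h)
⟦⟧-cong (addE a b) ρ σ h = cong₂ _+_ (⟦⟧-cong a ρ σ h) (⟦⟧-cong b ρ σ h)
⟦⟧-cong (subE a b) ρ σ h = cong₂ _∸_ (⟦⟧-cong a ρ σ h) (⟦⟧-cong b ρ σ h)
⟦⟧-cong (ifz c a b) ρ σ h rewrite ⟦⟧-cong c ρ σ h | ⟦⟧-cong a ρ σ h | ⟦⟧-cong b ρ σ h = refl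
⟦⟧-cong (it s n a b f g) ρ σ h rewrite ⟦⟧-cong n ρ σ h | ⟦⟧-cong a ρ σ h | ⟦⟧-cong b ρ σ h =
  cong (select s) (iter-cong _ _ (λ p → cong₂ _,_
     (⟦⟧-cong f _ _ (extend-cong (proj₁ p) (proj₂ p) ρ σ h)) (⟦⟧-cong g _ _ (extend-cong (proj₁ p) (proj₂ p) ρ σ h))) (⟦ n ⟧ σ) (⟦ a ⟧ σ , ⟦ b ⟧ σ))

envOf : List ℕ → (ℕ → ℕ) → ℕ → ℕ
envOf [] R i = 0
envOf (r ∷ ρl) R zero = R r
envOf (r ∷ ρl) R (suc i) = envOf ρl R i

compileVar : List ℕ → ℕ → ℕ → ℕ → LoopProg
compileVar [] sp out i = CLR out
compileVar (r ∷ ρl) sp out zero = COPY r out sp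
compileVar (r ∷ ρl) sp out (suc i) = compileVar ρl sp out i

selectReg : Bool → ℕ → ℕ → ℕ
selectReg true x y = x
selectReg false x y = y

-- compileExpr ρl sp out e leaves the value of e in register out, reading variable i
-- from the i-th register of ρl and using the registers from sp on as scratch.
compileExpr : List ℕ → ℕ → ℕ → Expr → LoopProg
iterBody : ℕ → List ℕ → Expr → Expr → LoopProg

compileExpr ρl sp out (var i) = compileVar ρl sp out i
compileExpr ρl sp out (lit c) = CLR out ⨾ INCS out c
compileExpr ρl sp out (sucE e) = compileExpr ρl sp out e ⨾ INC out
compileExpr ρl sp out (predE e) = compileExpr ρl sp out e ⨾ DEC out
compileExpr ρl sp out (addE a b) = compileExpr ρl sp out a ⨾ compileExpr ρl (suc sp) sp b ⨾ MOV sp out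
compileExpr ρl sp out (subE a b) = compileExpr ρl sp out a ⨾ compileExpr ρl (suc sp) sp b ⨾ LOOP sp (DEC out)
compileExpr ρl sp out (ifz c a b) =
  compileExpr ρl (suc sp) sp c ⨾ compileExpr ρl (suc sp) out b ⨾ CLR (suc sp) ⨾ INC (suc sp) ⨾
  LOOP sp (CLR (suc sp)) ⨾ LOOP (suc sp) (compileExpr ρl (suc (suc sp)) out a)
compileExpr ρl sp out (it s n a b f g) =
  compileExpr ρl (suc sp) sp a ⨾ compileExpr ρl (2 + sp) (1 + sp) b ⨾ compileExpr ρl (3 + sp) (2 + sp) n ⨾
  LOOP (2 + sp) (iterBody sp ρl f g) ⨾ CLR out ⨾ MOV (selectReg s sp (1 + sp)) out

iterBody sp ρl f g = compileExpr (sp ∷ 1 + sp ∷ ρl) (5 + sp) (3 + sp) f ⨾ compileExpr (sp ∷ 1 + sp ∷ ρl) (5 + sp) (4 + sp) g ⨾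
     CLR sp ⨾ MOV (3 + sp) sp ⨾ CLR (1 + sp) ⨾ MOV (4 + sp) (1 + sp)

record Layout (ρl : List ℕ) (sp out : ℕ) : Set where
  constructor layout
  field
    ρ< : All (_< sp) ρl
    o< : out < sp
    ρo : All (λ r → Distinct r out) ρl
open Layout

Frame : LoopProg → ℕ → ℕ → Set
Frame p sp out = ∀ R i → i < sp → Distinct i out → eval p R i ≡ R i

envOf-agree : ∀ ρl sp S R → All (_< sp) ρl → (∀ i → i < sp → S i ≡ R i) → ∀ j → envOf ρl S j ≡ envOf ρl R j
envOf-agree [] sp S R a h j = refl
envOf-agree (r ∷ ρl) sp S R (p ∷ a) h zero = h r p
envOf-agree (r ∷ ρl) sp S R (p ∷ a) h (suc j) = envOf-agree ρl sp S R a h j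

envOf-agree′ : ∀ ρl sp out S R → Layout ρl sp out → (∀ i → i < sp → Distinct i out → S i ≡ R i) → ∀ j → envOf ρl S j ≡ envOf ρl R j
envOf-agree′ [] sp out S R g h j = refl
envOf-agree′ (r ∷ ρl) sp out S R (layout (p ∷ a) o (q ∷ b)) h zero = h r p q
envOf-agree′ (r ∷ ρl) sp out S R (layout (p ∷ a) o (q ∷ b)) h (suc j) = envOf-agree′ ρl sp out S R (layout a o b) h j

n<1+k+n : ∀ k n → n < suc k + n
n<1+k+n k n = s≤s (m≤n+m n k)

<-weaken : ∀ {i sp} → i < sp → ∀ k → i < k + sp
<-weaken {i} {sp} p k = ≤-trans p (m≤n+m sp k)

layout-widen : ∀ {ρl sp out sp'} → Layout ρl sp out → sp ≤ sp' → Layout ρl sp' out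
layout-widen (layout a o b) le = layout (allMap (λ p → ≤-trans p le) a) (≤-trans o le) b

layout-scratch : ∀ {ρl sp out' sp'} → All (_< sp) ρl → sp ≤ out' → out' < sp' → Layout ρl sp' out'
layout-scratch {ρl} a le o = layout (allMap (λ p → ≤-trans p (≤-trans le (<⇒≤ o))) a) o
  (allMap (λ p → <⇒Distinct (≤-trans p le)) a)

layout-body : ∀ {ρl sp} k → k < 2 → All (_< sp) ρl → Layout (sp ∷ suc sp ∷ ρl) (5 + sp) (3 + k + sp)
layout-body {ρl} {sp} k k<2 a = layout
   (n<1+k+n 4 sp ∷ n<1+k+n 3 (suc sp) ∷ allMap (λ p → <-weaken p 5) a)
   (s≤s (s≤s (s≤s (+-monoˡ-< sp k<2))))
   (<⇒Distinct (n<1+k+n (2 + k) sp) ∷ <⇒Distinct (s≤s (n<1+k+n (1 + k) sp)) ∷ allMap (λ p → <⇒Distinct (<-weaken p (3 + k))) a)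

compileVar-frame : ∀ ρl i sp out → Layout ρl sp out → Frame (compileVar ρl sp out i) sp out
compileVar-frame [] i sp out g R j j< jo = CLR-frame out R j jo
compileVar-frame (r ∷ ρl) zero sp out (layout (p ∷ a) o (q ∷ b)) R j j< jo with j ≡ᵇ r in eq
... | true rewrite ≡ᵇ≡true⇒≡ j r eq = COPY-correct.source-kept r out sp q (<⇒Distinct p) (<⇒Distinct o) R
... | false = COPY-frame r out sp R j eq jo (<⇒Distinct j<)
compileVar-frame (r ∷ ρl) (suc i) sp out (layout (p ∷ a) o (q ∷ b)) = compileVar-frame ρl i sp out (layout a o b)

compileExpr-frame : ∀ e ρl sp out → Layout ρl sp out → Frame (compileExpr ρl sp out e) sp out
iterBody-frame : ∀ sp ρl f g → All (_< sp) ρl → ∀ i → i < sp → ∀ S → eval (iterBody sp ρl f g) S i ≡ S i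

compileExpr-frame (var i) ρl sp out g = compileVar-frame ρl i sp out g
compileExpr-frame (lit c) ρl sp out g R i i< io = trans (addReg-frame out c (eval (CLR out) R) i io) (CLR-frame out R i io)
compileExpr-frame (sucE e) ρl sp out g R i i< io = trans (setReg-ne (eval (compileExpr ρl sp out e) R) out _ i io) (compileExpr-frame e ρl sp out g R i i< io)
compileExpr-frame (predE e) ρl sp out g R i i< io = trans (DEC-frame out (eval (compileExpr ρl sp out e) R) i io) (compileExpr-frame e ρl sp out g R i i< io)
compileExpr-frame (addE a b) ρl sp out g R i i< io =
  trans (MOV-frame sp out S2 i (<⇒Distinct i<) io)
  (trans (compileExpr-frame b ρl (suc sp) sp (layout-scratch (ρ< g) ≤-refl ≤-refl) S1 i (<-weaken i< 1) (<⇒Distinct i<))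
         (compileExpr-frame a ρl sp out g R i i< io))
  where
  S1 = eval (compileExpr ρl sp out a) R
  S2 = eval (compileExpr ρl (suc sp) sp b) S1
compileExpr-frame (subE a b) ρl sp out g R i i< io =
  trans (iterLoop-preserves sp (DEC out) i (<⇒Distinct i<) (λ S → DEC-frame out S i io) (S2 sp) S2)
  (trans (compileExpr-frame b ρl (suc sp) sp (layout-scratch (ρ< g) ≤-refl ≤-refl) S1 i (<-weaken i< 1) (<⇒Distinct i<))
         (compileExpr-frame a ρl sp out g R i i< io))
  where
  S1 = eval (compileExpr ρl sp out a) R
  S2 = eval (compileExpr ρl (suc sp) sp b) S1
compileExpr-frame (ifz c a b) ρl sp out g R i i< io =
  trans (iterLoop-preserves (suc sp) (compileExpr ρl (2 + sp) out a) i (<⇒Distinct (<-weaken i< 1)) (λ S → compileExpr-frame a ρl (2 + sp) out (layout-widen g (≤-trans (n≤1+n sp) (n≤1+n (suc sp)))) S i (<-weaken i< 2) io) (S5 (suc sp)) S5)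
  (trans (iterLoop-preserves sp (CLR (suc sp)) i (<⇒Distinct i<) (λ S → CLR-frame (suc sp) S i (<⇒Distinct (<-weaken i< 1))) (S4 sp) S4)
  (trans (setReg-ne S3 (suc sp) _ i (<⇒Distinct (<-weaken i< 1)))
  (trans (CLR-frame (suc sp) S2 i (<⇒Distinct (<-weaken i< 1)))
  (trans (compileExpr-frame b ρl (suc sp) out (layout-widen g (n≤1+n sp)) S1 i (<-weaken i< 1) io)
         (compileExpr-frame c ρl (suc sp) sp (layout-scratch (ρ< g) ≤-refl ≤-refl) R i (<-weaken i< 1) (<⇒Distinct i<))))))
  where
  S1 = eval (compileExpr ρl (suc sp) sp c) R
  S2 = eval (compileExpr ρl (suc sp) out b) S1
  S3 = eval (CLR (suc sp)) S2
  S4 = eval (INC (suc sp)) S3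
  S5 = eval (LOOP sp (CLR (suc sp))) S4
compileExpr-frame (it s n a b f g) ρl sp out gd R i i< io =
  trans (MOV-frame (selectReg s sp (1 + sp)) out S5 i (selNe s) io)
  (trans (CLR-frame out S4 i io)
  (trans (iterLoop-preserves (2 + sp) (iterBody sp ρl f g) i (<⇒Distinct (<-weaken i< 2)) (iterBody-frame sp ρl f g (ρ< gd) i i<) (S3 (2 + sp)) S3)
  (trans (compileExpr-frame n ρl (3 + sp) (2 + sp) (layout-scratch (ρ< gd) (m≤n+m sp 2) (n<1+k+n 0 (2 + sp))) S2 i (<-weaken i< 3) (<⇒Distinct (<-weaken i< 2)))
  (trans (compileExpr-frame b ρl (2 + sp) (1 + sp) (layout-scratch (ρ< gd) (m≤n+m sp 1) (n<1+k+n 0 (1 + sp))) S1 i (<-weaken i< 2) (<⇒Distinct (<-weaken i< 1)))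
         (compileExpr-frame a ρl (1 + sp) sp (layout-scratch (ρ< gd) ≤-refl ≤-refl) R i (<-weaken i< 1) (<⇒Distinct i<))))))
  where
  S1 = eval (compileExpr ρl (1 + sp) sp a) R
  S2 = eval (compileExpr ρl (2 + sp) (1 + sp) b) S1
  S3 = eval (compileExpr ρl (3 + sp) (2 + sp) n) S2
  S4 = eval (LOOP (2 + sp) (iterBody sp ρl f g)) S3
  S5 = eval (CLR out) S4
  selNe : ∀ s → Distinct i (selectReg s sp (1 + sp))
  selNe true = <⇒Distinct i<
  selNe false = <⇒Distinct (<-weaken i< 1)

Distinct-<1+k+ : ∀ k n → Distinct n (suc k + n)
Distinct-<1+k+ k n = <⇒Distinct (n<1+k+n k n)
Distinct->1+k+ : ∀ k n → Distinct (suc k + n) n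
Distinct->1+k+ k n = >⇒Distinct (n<1+k+n k n)

iterBody-frame sp ρl f g al i i< S =
    trans (MOV-frame (4 + sp) (1 + sp) B5 i (<⇒Distinct (<-weaken i< 4)) (<⇒Distinct (<-weaken i< 1)))
    (trans (CLR-frame (1 + sp) B4 i (<⇒Distinct (<-weaken i< 1)))
    (trans (MOV-frame (3 + sp) sp B3 i (<⇒Distinct (<-weaken i< 3)) (<⇒Distinct i<))
    (trans (CLR-frame sp B2 i (<⇒Distinct i<))
    (trans (compileExpr-frame g _ (5 + sp) (4 + sp) (layout-body 1 (s≤s (s≤s z≤n)) al) B1 i (<-weaken i< 5) (<⇒Distinct (<-weaken i< 4)))
           (compileExpr-frame f _ (5 + sp) (3 + sp) (layout-body 0 (s≤s z≤n) al) S i (<-weaken i< 5) (<⇒Distinct (<-weaken i< 3)))))))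
    where
    B1 = eval (compileExpr (sp ∷ 1 + sp ∷ ρl) (5 + sp) (3 + sp) f) S
    B2 = eval (compileExpr (sp ∷ 1 + sp ∷ ρl) (5 + sp) (4 + sp) g) B1
    B3 = eval (CLR sp) B2
    B4 = eval (MOV (3 + sp) sp) B3
    B5 = eval (CLR (1 + sp)) B4

eval-envOf-agree : ∀ e {ρl sp out} → Layout ρl sp out → ∀ S R → (∀ i → i < sp → Distinct i out → S i ≡ R i) →
  ⟦ e ⟧ (envOf ρl S) ≡ ⟦ e ⟧ (envOf ρl R)
eval-envOf-agree e {ρl} {sp} {out} g S R h = ⟦⟧-cong e _ _ (envOf-agree′ ρl sp out S R g h)

compileVar-value : ∀ ρl i sp out → Layout ρl sp out → ∀ R → eval (compileVar ρl sp out i) R out ≡ envOf ρl R i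
compileVar-value [] i sp out g R = CLR-clears out R
compileVar-value (r ∷ ρl) zero sp out (layout (p ∷ a) o (q ∷ b)) R = COPY-correct.target-copied r out sp q (<⇒Distinct p) (<⇒Distinct o) R
compileVar-value (r ∷ ρl) (suc i) sp out (layout (p ∷ a) o (q ∷ b)) R = compileVar-value ρl i sp out (layout a o b) R

CompilesCorrectly : Expr → Set
CompilesCorrectly e = ∀ ρl sp out → Layout ρl sp out → ∀ R → eval (compileExpr ρl sp out e) R out ≡ ⟦ e ⟧ (envOf ρl R)

ifz-value : ∀ c a b → CompilesCorrectly c → CompilesCorrectly a → CompilesCorrectly b → CompilesCorrectly (ifz c a b)
ifz-value c a b c-value a-value b-value ρl sp out g R = fin (⟦ c ⟧ (envOf ρl R)) s4sp
  where
  gh = layout-scratch (ρ< g) ≤-refl ≤-refl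
  g1 = layout-widen g (n≤1+n sp)
  g2 = layout-widen g (≤-trans (n≤1+n sp) (n≤1+n (suc sp)))
  S1 = eval (compileExpr ρl (suc sp) sp c) R
  S2 = eval (compileExpr ρl (suc sp) out b) S1
  S3 = eval (CLR (suc sp)) S2
  S4 = eval (INC (suc sp)) S3
  S5 = eval (LOOP sp (CLR (suc sp))) S4
  A = compileExpr ρl (2 + sp) out a
  nsp : Distinct sp (suc sp)
  nsp = <⇒Distinct (n<1+k+n 0 sp)
  nsp' : Distinct (suc sp) sp
  nsp' = >⇒Distinct (n<1+k+n 0 sp)
  no1 : Distinct out (suc sp)
  no1 = <⇒Distinct (<-weaken (o< g) 1)
  no0 : Distinct out sp
  no0 = <⇒Distinct (o< g)
  s4sp : S4 sp ≡ ⟦ c ⟧ (envOf ρl R)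
  s4sp = trans (setReg-ne S3 (suc sp) _ sp nsp) (trans (CLR-frame (suc sp) S2 sp nsp)
           (trans (compileExpr-frame b ρl (suc sp) out g1 S1 sp (n<1+k+n 0 sp) (>⇒Distinct (o< g))) (c-value ρl (suc sp) sp gh R)))
  s4f : S4 (suc sp) ≡ 1
  s4f = trans (setReg-eq S3 (suc sp) _) (cong suc (CLR-clears (suc sp) S2))
  s5f : S5 (suc sp) ≡ isZero (S4 sp)
  s5f = trans (iterLoop-view (λ S → S (suc sp)) (λ _ → 0) sp (CLR (suc sp)) (λ S m → setReg-ne S sp m (suc sp) nsp')
                 (λ S → CLR-clears (suc sp) S) (S4 sp) S4)
         (trans (cong (iter (S4 sp) (λ _ → 0)) s4f) (iter-const-isZero (S4 sp)))
  s5fr : ∀ i → i < suc sp → Distinct i sp → Distinct i (suc sp) → Distinct i out → S5 i ≡ R i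
  s5fr i i< h0 h1 ho = trans (iterLoop-preserves sp (CLR (suc sp)) i h0 (λ S → CLR-frame (suc sp) S i h1) (S4 sp) S4)
    (trans (setReg-ne S3 (suc sp) _ i h1) (trans (CLR-frame (suc sp) S2 i h1)
    (trans (compileExpr-frame b ρl (suc sp) out g1 S1 i i< ho) (compileExpr-frame c ρl (suc sp) sp gh R i i< h0))))
  s5out : S5 out ≡ ⟦ b ⟧ (envOf ρl R)
  s5out = trans (iterLoop-preserves sp (CLR (suc sp)) out no0 (λ S → CLR-frame (suc sp) S out no1) (S4 sp) S4)
    (trans (setReg-ne S3 (suc sp) _ out no1) (trans (CLR-frame (suc sp) S2 out no1)
    (trans (b-value ρl (suc sp) out g1 S1) (eval-envOf-agree b g S1 R (λ i i< io → compileExpr-frame c ρl (suc sp) sp gh R i (<-weaken i< 1) (<⇒Distinct i<))))))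
  fin : ∀ v → S4 sp ≡ v → iterLoop (suc sp) A (S5 (suc sp)) S5 out ≡ ifZero v (⟦ a ⟧ (envOf ρl R)) (⟦ b ⟧ (envOf ρl R))
  fin zero e = trans (iterLoop-once (suc sp) A S5 (trans s5f (cong isZero e)) out)
     (trans (a-value ρl (2 + sp) out g2 (setReg S5 (suc sp) 0))
       (eval-envOf-agree a g (setReg S5 (suc sp) 0) R (λ i i< io → trans (setReg-ne S5 (suc sp) 0 i (<⇒Distinct (<-weaken i< 1)))
           (s5fr i (<-weaken i< 1) (<⇒Distinct i<) (<⇒Distinct (<-weaken i< 1)) io))))
  fin (suc v) e = trans (iterLoop-never (suc sp) A S5 (trans s5f (cong isZero e)) out) s5out

iterBody-step : ∀ {ρl sp} f g → CompilesCorrectly f → CompilesCorrectly g → All (_< sp) ρl → ∀ R S → (∀ i → i < sp → S i ≡ R i) →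
  (eval (iterBody sp ρl f g) S sp , eval (iterBody sp ρl f g) S (1 + sp)) ≡
  (⟦ f ⟧ (extend (S sp) (S (1 + sp)) (envOf ρl R)) , ⟦ g ⟧ (extend (S sp) (S (1 + sp)) (envOf ρl R)))
iterBody-step {ρl} {sp} f g f-value g-value al R S iS = cong₂ _,_ e1 e2
  where
  ρ = envOf ρl R
  ρ' = sp ∷ 1 + sp ∷ ρl
  gB0 = layout-body {ρl} {sp} 0 (s≤s z≤n) al
  gB1 = layout-body {ρl} {sp} 1 (s≤s (s≤s z≤n)) al
  B1 = eval (compileExpr ρ' (5 + sp) (3 + sp) f) S
  B2 = eval (compileExpr ρ' (5 + sp) (4 + sp) g) B1
  B3 = eval (CLR sp) B2
  B4 = eval (MOV (3 + sp) sp) B3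
  B5 = eval (CLR (1 + sp)) B4
  envExt : ∀ j → envOf ρ' S j ≡ extend (S sp) (S (1 + sp)) ρ j
  envExt zero = refl
  envExt (suc zero) = refl
  envExt (suc (suc j)) = envOf-agree ρl sp S R al iS j
  envB1 : ∀ j → envOf ρ' B1 j ≡ envOf ρ' S j
  envB1 = envOf-agree′ ρ' (5 + sp) (3 + sp) B1 S gB0 (compileExpr-frame f ρ' (5 + sp) (3 + sp) gB0 S)
  e1 : eval (MOV (4 + sp) (1 + sp)) B5 sp ≡ ⟦ f ⟧ (extend (S sp) (S (1 + sp)) ρ)
  e1 = trans (MOV-frame (4 + sp) (1 + sp) B5 sp (Distinct-<1+k+ 3 sp) (Distinct-<1+k+ 0 sp))
       (trans (CLR-frame (1 + sp) B4 sp (Distinct-<1+k+ 0 sp))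
       (trans (MOV-adds (3 + sp) sp (Distinct->1+k+ 2 sp) B3)
       (trans (cong₂ _+_ (trans (CLR-frame sp B2 (3 + sp) (Distinct->1+k+ 2 sp))
                 (trans (compileExpr-frame g ρ' (5 + sp) (4 + sp) gB1 B1 (3 + sp) (n<1+k+n 1 (3 + sp)) (Distinct-<1+k+ 0 (3 + sp)))
                   (f-value ρ' (5 + sp) (3 + sp) gB0 S)))
                 (CLR-clears sp B2))
       (trans (+-identityʳ _) (⟦⟧-cong f _ _ envExt)))))
  e2 : eval (MOV (4 + sp) (1 + sp)) B5 (1 + sp) ≡ ⟦ g ⟧ (extend (S sp) (S (1 + sp)) ρ)
  e2 = trans (MOV-adds (4 + sp) (1 + sp) (Distinct->1+k+ 2 (1 + sp)) B5)
       (trans (cong₂ _+_ (trans (CLR-frame (1 + sp) B4 (4 + sp) (Distinct->1+k+ 2 (1 + sp)))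
                 (trans (MOV-frame (3 + sp) sp B3 (4 + sp) (Distinct->1+k+ 0 (3 + sp)) (Distinct->1+k+ 3 sp))
                 (trans (CLR-frame sp B2 (4 + sp) (Distinct->1+k+ 3 sp))
                   (g-value ρ' (5 + sp) (4 + sp) gB1 B1))))
                 (CLR-clears (1 + sp) B4))
       (trans (+-identityʳ _) (trans (⟦⟧-cong g _ _ envB1) (⟦⟧-cong g _ _ envExt))))

it-value : ∀ s n a b f g → CompilesCorrectly n → CompilesCorrectly a → CompilesCorrectly b →
  CompilesCorrectly f → CompilesCorrectly g → CompilesCorrectly (it s n a b f g)
it-value s n a b f g n-value a-value b-value f-value g-value ρl sp out gd R =
  trans (MOV-adds (selectReg s sp (1 + sp)) out (selNe s) S5)
  (trans (cong₂ _+_ (CLR-frame out S4 _ (selNe s)) (CLR-clears out S4))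
  (trans (+-identityʳ _)
  (trans (selV s S4)
  (cong (select s) (trans (proj₁ LI) (cong₂ (λ k v → iter k F v) s3n (cong₂ _,_ (trans s3x (trans s2x s1x)) (trans s3y s2y))))))))
  where
  ρ = envOf ρl R
  al = ρ< gd
  gh1 = layout-scratch {sp' = 1 + sp} al ≤-refl ≤-refl
  gh2 = layout-scratch {sp' = 2 + sp} al (m≤n+m sp 1) (n<1+k+n 0 (1 + sp))
  gh3 = layout-scratch {sp' = 3 + sp} al (m≤n+m sp 2) (n<1+k+n 0 (2 + sp))
  S1 = eval (compileExpr ρl (1 + sp) sp a) R
  S2 = eval (compileExpr ρl (2 + sp) (1 + sp) b) S1
  S3 = eval (compileExpr ρl (3 + sp) (2 + sp) n) S2
  S4 = eval (LOOP (2 + sp) (iterBody sp ρl f g)) S3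
  S5 = eval (CLR out) S4
  selNe : ∀ s → Distinct (selectReg s sp (1 + sp)) out
  selNe true = >⇒Distinct (o< gd)
  selNe false = >⇒Distinct (<-weaken (o< gd) 1)
  selV : ∀ s S → S (selectReg s sp (1 + sp)) ≡ select s (S sp , S (1 + sp))
  selV true S = refl
  selV false S = refl
  fr1 : ∀ i → i < sp → S1 i ≡ R i
  fr1 i i< = compileExpr-frame a ρl (1 + sp) sp gh1 R i (<-weaken i< 1) (<⇒Distinct i<)
  fr2 : ∀ i → i < sp → S2 i ≡ R i
  fr2 i i< = trans (compileExpr-frame b ρl (2 + sp) (1 + sp) gh2 S1 i (<-weaken i< 2) (<⇒Distinct (<-weaken i< 1))) (fr1 i i<)
  fr3 : ∀ i → i < sp → S3 i ≡ R i
  fr3 i i< = trans (compileExpr-frame n ρl (3 + sp) (2 + sp) gh3 S2 i (<-weaken i< 3) (<⇒Distinct (<-weaken i< 2))) (fr2 i i<)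
  s1x : S1 sp ≡ ⟦ a ⟧ ρ
  s1x = a-value ρl (1 + sp) sp gh1 R
  s2y : S2 (1 + sp) ≡ ⟦ b ⟧ ρ
  s2y = trans (b-value ρl (2 + sp) (1 + sp) gh2 S1) (eval-envOf-agree b gd S1 R (λ i i< io → fr1 i i<))
  s2x : S2 sp ≡ S1 sp
  s2x = compileExpr-frame b ρl (2 + sp) (1 + sp) gh2 S1 sp (n<1+k+n 1 sp) (Distinct-<1+k+ 0 sp)
  s3n : S3 (2 + sp) ≡ ⟦ n ⟧ ρ
  s3n = trans (n-value ρl (3 + sp) (2 + sp) gh3 S2) (eval-envOf-agree n gd S2 R (λ i i< io → fr2 i i<))
  s3x : S3 sp ≡ S2 sp
  s3x = compileExpr-frame n ρl (3 + sp) (2 + sp) gh3 S2 sp (n<1+k+n 2 sp) (Distinct-<1+k+ 1 sp)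
  s3y : S3 (1 + sp) ≡ S2 (1 + sp)
  s3y = compileExpr-frame n ρl (3 + sp) (2 + sp) gh3 S2 (1 + sp) (n<1+k+n 1 (1 + sp)) (Distinct-<1+k+ 0 (1 + sp))
  I : (ℕ → ℕ) → Set
  I S = ∀ i → i < sp → S i ≡ R i
  V : (ℕ → ℕ) → ℕ × ℕ
  V S = (S sp , S (1 + sp))
  F : ℕ × ℕ → ℕ × ℕ
  F = exprStep f g ρ
  i1 : ∀ S m → I S → I (setReg S (2 + sp) m)
  i1 S m iS i i< = trans (setReg-ne S (2 + sp) m i (<⇒Distinct (<-weaken i< 2))) (iS i i<)
  i2 : ∀ S → I S → I (eval (iterBody sp ρl f g) S)
  i2 S iS i i< = trans (iterBody-frame sp ρl f g al i i< S) (iS i i<)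
  hs : ∀ S m → V (setReg S (2 + sp) m) ≡ V S
  hs S m = cong₂ _,_ (setReg-ne S (2 + sp) m sp (Distinct-<1+k+ 1 sp)) (setReg-ne S (2 + sp) m (1 + sp) (Distinct-<1+k+ 0 (1 + sp)))
  hb : ∀ S → I S → V (eval (iterBody sp ρl f g) S) ≡ F (V S)
  hb = iterBody-step f g f-value g-value al R
  LI = iterLoop-invariant I V F (2 + sp) (iterBody sp ρl f g) i1 i2 hs hb (S3 (2 + sp)) S3 fr3

compileExpr-value : ∀ e → CompilesCorrectly e
compileExpr-value (var i) ρl sp out g R = compileVar-value ρl i sp out g R
compileExpr-value (lit c) ρl sp out g R = trans (addReg-value out c (eval (CLR out) R)) (trans (cong (c +_) (CLR-clears out R)) (+-identityʳ c))
compileExpr-value (sucE e) ρl sp out g R = trans (setReg-eq (eval (compileExpr ρl sp out e) R) out _) (cong suc (compileExpr-value e ρl sp out g R))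
compileExpr-value (predE e) ρl sp out g R = trans (DEC-value out (eval (compileExpr ρl sp out e) R)) (cong predℕ (compileExpr-value e ρl sp out g R))
compileExpr-value (addE a b) ρl sp out g R =
  trans (MOV-adds sp out (>⇒Distinct (o< g)) S2)
   (trans (cong₂ _+_ (trans (compileExpr-value b ρl (suc sp) sp gh S1) (eval-envOf-agree b g S1 R (compileExpr-frame a ρl sp out g R)))
                     (trans (compileExpr-frame b ρl (suc sp) sp gh S1 out (<-weaken (o< g) 1) (<⇒Distinct (o< g))) (compileExpr-value a ρl sp out g R)))
          (+-comm (⟦ b ⟧ (envOf ρl R)) (⟦ a ⟧ (envOf ρl R))))
  where
  gh = layout-scratch (ρ< g) ≤-refl ≤-refl
  S1 = eval (compileExpr ρl sp out a) R
  S2 = eval (compileExpr ρl (suc sp) sp b) S1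
compileExpr-value (subE a b) ρl sp out g R =
  trans (iterLoop-view (λ S → S out) predℕ sp (DEC out) (λ S m → setReg-ne S sp m out (<⇒Distinct (o< g))) (λ S → DEC-value out S) (S2 sp) S2)
   (trans (iter-pred (S2 sp) (S2 out))
     (cong₂ _∸_ (trans (compileExpr-frame b ρl (suc sp) sp gh S1 out (<-weaken (o< g) 1) (<⇒Distinct (o< g))) (compileExpr-value a ρl sp out g R))
                (trans (compileExpr-value b ρl (suc sp) sp gh S1) (eval-envOf-agree b g S1 R (compileExpr-frame a ρl sp out g R)))))
  where
  gh = layout-scratch (ρ< g) ≤-refl ≤-refl
  S1 = eval (compileExpr ρl sp out a) R
  S2 = eval (compileExpr ρl (suc sp) sp b) S1
compileExpr-value (ifz c a b) = ifz-value c a b (compileExpr-value c) (compileExpr-value a) (compileExpr-value b)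
compileExpr-value (it s n a b f g) = it-value s n a b f g (compileExpr-value n) (compileExpr-value a) (compileExpr-value b)
  (compileExpr-value f) (compileExpr-value g)

compileVar-writes : ∀ ρl sp out n i → i < sp → Distinct i out → notIn i ρl ≡ true → notIn i (writes (compileVar ρl sp out n)) ≡ true
compileVar-writes [] sp out n i i< io ir = notIn-LOOP i out skip io refl
compileVar-writes (r ∷ ρl) sp out zero i i< io ir =
  notIn-⨾ i (CLR out) (CLR sp ⨾ LOOP r (INC out ⨾ INC sp) ⨾ MOV sp r) (notIn-LOOP i out skip io refl) (notIn-⨾ i (CLR sp) (LOOP r (INC out ⨾ INC sp) ⨾ MOV sp r) (notIn-LOOP i sp skip nsp refl)
    (notIn-⨾ i (LOOP r (INC out ⨾ INC sp)) (MOV sp r) (notIn-LOOP i r (INC out ⨾ INC sp) nr (notIn-⨾ i (INC out) (INC sp) (notIn-singleton i out io) (notIn-singleton i sp nsp))) (notIn-LOOP i sp (INC r) nsp (notIn-singleton i r nr))))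
  where
  nsp = <⇒Distinct i<
  nr = not-injective {y = false} (∧-conicalˡ (not (i ≡ᵇ r)) _ ir)
compileVar-writes (r ∷ ρl) sp out (suc n) i i< io ir = compileVar-writes ρl sp out n i i< io (∧-conicalʳ (not (i ≡ᵇ r)) _ ir)

KeepsBelow : Expr → Set
KeepsBelow e = ∀ ρl sp out i → i < sp → Distinct i out → notIn i ρl ≡ true → notIn i (writes (compileExpr ρl sp out e)) ≡ true

iterBody-writes : ∀ {ρl sp} f g → KeepsBelow f → KeepsBelow g → ∀ i → i < 5 + sp →
  Distinct i sp → Distinct i (1 + sp) → Distinct i (3 + sp) → Distinct i (4 + sp) → notIn i ρl ≡ true →
  notIn i (writes (iterBody sp ρl f g)) ≡ true
iterBody-writes {ρl} {sp} f g f-keeps g-keeps i i<5+sp i≢0 i≢1 i≢3 i≢4 i∉ρl =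
  notIn-⨾ i Pf rest₁ (f-keeps ρ' (5 + sp) (3 + sp) i i<5+sp i≢3 i∉ρ')
  (notIn-⨾ i Pg rest₂ (g-keeps ρ' (5 + sp) (4 + sp) i i<5+sp i≢4 i∉ρ')
  (notIn-⨾ i (CLR sp) rest₃ (notIn-LOOP i sp skip i≢0 refl)
  (notIn-⨾ i (MOV (3 + sp) sp) rest₄ (notIn-LOOP i (3 + sp) (INC sp) i≢3 (notIn-singleton i sp i≢0))
  (notIn-⨾ i (CLR (1 + sp)) (MOV (4 + sp) (1 + sp)) (notIn-LOOP i (1 + sp) skip i≢1 refl)
     (notIn-LOOP i (4 + sp) (INC (1 + sp)) i≢4 (notIn-singleton i (1 + sp) i≢1))))))
  where
  ρ' : List ℕ
  ρ' = sp ∷ 1 + sp ∷ ρl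
  i∉ρ' : notIn i ρ' ≡ true
  i∉ρ' = ∧-intro (Distinct⇒not {i} {sp} i≢0) (∧-intro (Distinct⇒not {i} {1 + sp} i≢1) i∉ρl)
  Pf Pg rest₁ rest₂ rest₃ rest₄ : LoopProg
  Pf = compileExpr ρ' (5 + sp) (3 + sp) f
  Pg = compileExpr ρ' (5 + sp) (4 + sp) g
  rest₄ = CLR (1 + sp) ⨾ MOV (4 + sp) (1 + sp)
  rest₃ = MOV (3 + sp) sp ⨾ rest₄
  rest₂ = CLR sp ⨾ rest₃
  rest₁ = Pg ⨾ rest₂

compileExpr-writes : ∀ e → KeepsBelow e
compileExpr-writes (var n) ρl sp out i i< io ir = compileVar-writes ρl sp out n i i< io ir
compileExpr-writes (lit c) ρl sp out i i< io ir = notIn-⨾ i (CLR out) (INCS out c) (notIn-LOOP i out skip io refl) (notIn-singleton i out io)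
compileExpr-writes (sucE e) ρl sp out i i< io ir = notIn-⨾ i (compileExpr ρl sp out e) (INC out) (compileExpr-writes e ρl sp out i i< io ir) (notIn-singleton i out io)
compileExpr-writes (predE e) ρl sp out i i< io ir = notIn-⨾ i (compileExpr ρl sp out e) (DEC out) (compileExpr-writes e ρl sp out i i< io ir) (notIn-singleton i out io)
compileExpr-writes (addE a b) ρl sp out i i< io ir =
  notIn-⨾ i (compileExpr ρl sp out a) (compileExpr ρl (suc sp) sp b ⨾ MOV sp out) (compileExpr-writes a ρl sp out i i< io ir) (notIn-⨾ i (compileExpr ρl (suc sp) sp b) (MOV sp out)
    (compileExpr-writes b ρl (suc sp) sp i (<-weaken i< 1) (<⇒Distinct i<) ir) (notIn-LOOP i sp (INC out) (<⇒Distinct i<) (notIn-singleton i out io)))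
compileExpr-writes (subE a b) ρl sp out i i< io ir =
  notIn-⨾ i (compileExpr ρl sp out a) (compileExpr ρl (suc sp) sp b ⨾ LOOP sp (DEC out)) (compileExpr-writes a ρl sp out i i< io ir) (notIn-⨾ i (compileExpr ρl (suc sp) sp b) (LOOP sp (DEC out))
    (compileExpr-writes b ρl (suc sp) sp i (<-weaken i< 1) (<⇒Distinct i<) ir) (notIn-LOOP i sp (DEC out) (<⇒Distinct i<) (notIn-singleton i out io)))
compileExpr-writes (ifz c a b) ρl sp out i i< io ir =
  notIn-⨾ i Pc Q1 (compileExpr-writes c ρl (suc sp) sp i (<-weaken i< 1) (<⇒Distinct i<) ir)
  (notIn-⨾ i Pb Q2 (compileExpr-writes b ρl (suc sp) out i (<-weaken i< 1) io ir)
  (notIn-⨾ i (CLR (suc sp)) Q3 (notIn-LOOP i (suc sp) skip ne1 refl) (notIn-⨾ i (INC (suc sp)) Q4 (notIn-singleton i (suc sp) ne1)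
  (notIn-⨾ i (LOOP sp (CLR (suc sp))) (LOOP (suc sp) Pa) (notIn-LOOP i sp (CLR (suc sp)) (<⇒Distinct i<) (notIn-LOOP i (suc sp) skip ne1 refl))
     (notIn-LOOP i (suc sp) Pa ne1 (compileExpr-writes a ρl (2 + sp) out i (<-weaken i< 2) io ir))))))
  where
  ne1 = <⇒Distinct (<-weaken i< 1)
  Pc = compileExpr ρl (suc sp) sp c
  Pb = compileExpr ρl (suc sp) out b
  Pa = compileExpr ρl (2 + sp) out a
  Q4 = LOOP sp (CLR (suc sp)) ⨾ LOOP (suc sp) Pa
  Q3 = INC (suc sp) ⨾ Q4
  Q2 = CLR (suc sp) ⨾ Q3
  Q1 = Pb ⨾ Q2
compileExpr-writes (it s n a b f g) ρl sp out i i< io ir =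
  notIn-⨾ i Pa T1 (compileExpr-writes a ρl (1 + sp) sp i (<-weaken i< 1) (<⇒Distinct i<) ir)
  (notIn-⨾ i Pb T2 (compileExpr-writes b ρl (2 + sp) (1 + sp) i (<-weaken i< 2) (<⇒Distinct (<-weaken i< 1)) ir)
  (notIn-⨾ i Pn T3 (compileExpr-writes n ρl (3 + sp) (2 + sp) i (<-weaken i< 3) (<⇒Distinct (<-weaken i< 2)) ir)
  (notIn-⨾ i (LOOP (2 + sp) (iterBody sp ρl f g)) Pend
     (notIn-LOOP i (2 + sp) (iterBody sp ρl f g) (<⇒Distinct (<-weaken i< 2))
        (iterBody-writes f g (compileExpr-writes f) (compileExpr-writes g) i (<-weaken i< 5)
           (<⇒Distinct i<) (<⇒Distinct (<-weaken i< 1)) (<⇒Distinct (<-weaken i< 3)) (<⇒Distinct (<-weaken i< 4)) ir))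
  (notIn-⨾ i (CLR out) (MOV (selectReg s sp (1 + sp)) out) (notIn-LOOP i out skip io refl)
     (notIn-LOOP i (selectReg s sp (1 + sp)) (INC out) (selNe s) (notIn-singleton i out io))))))
  where
  selNe : ∀ s → Distinct i (selectReg s sp (1 + sp))
  selNe true = <⇒Distinct i<
  selNe false = <⇒Distinct (<-weaken i< 1)
  Pa Pb Pn Pend T1 T2 T3 : LoopProg
  Pa = compileExpr ρl (1 + sp) sp a
  Pb = compileExpr ρl (2 + sp) (1 + sp) b
  Pn = compileExpr ρl (3 + sp) (2 + sp) n
  Pend = CLR out ⨾ MOV (selectReg s sp (1 + sp)) out
  T3 = LOOP (2 + sp) (iterBody sp ρl f g) ⨾ Pend
  T2 = Pn ⨾ T3
  T1 = Pb ⨾ T2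

compileVar-wf : ∀ ρl sp out n → Layout ρl sp out → wf (compileVar ρl sp out n) ≡ true
compileVar-wf [] sp out n g = refl
compileVar-wf (r ∷ ρl) sp out zero (layout (p ∷ a) o (q ∷ b)) =
  wf-⨾ {CLR out} {CLR sp ⨾ LOOP r (INC out ⨾ INC sp) ⨾ MOV sp r} refl
  (wf-⨾ {CLR sp} {LOOP r (INC out ⨾ INC sp) ⨾ MOV sp r} refl
  (wf-⨾ {LOOP r (INC out ⨾ INC sp)} {MOV sp r}
     (wf-LOOP {r} {INC out ⨾ INC sp} (notIn-⨾ (r) (INC out) (INC sp) (notIn-singleton (r) (out) q) (notIn-singleton (r) (sp) (<⇒Distinct p))) refl)
     (wf-LOOP {sp} {INC r} (notIn-singleton (sp) (r) (>⇒Distinct p)) refl)))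
compileVar-wf (r ∷ ρl) sp out (suc n) (layout (p ∷ a) o (q ∷ b)) = compileVar-wf ρl sp out n (layout a o b)

iterBody-wf : ∀ {ρl sp} f g → wf (compileExpr (sp ∷ 1 + sp ∷ ρl) (5 + sp) (3 + sp) f) ≡ true →
  wf (compileExpr (sp ∷ 1 + sp ∷ ρl) (5 + sp) (4 + sp) g) ≡ true → wf (iterBody sp ρl f g) ≡ true
iterBody-wf {ρl} {sp} f g f-wf g-wf =
  wf-⨾ {Pf} {rest₁} f-wf (wf-⨾ {Pg} {rest₂} g-wf (wf-⨾ {CLR sp} {rest₃} refl
  (wf-⨾ {MOV (3 + sp) sp} {rest₄} (wf-LOOP {3 + sp} {INC sp} (notIn-singleton (3 + sp) sp (Distinct->1+k+ 2 sp)) refl)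
  (wf-⨾ {CLR (1 + sp)} {MOV (4 + sp) (1 + sp)} refl
     (wf-LOOP {4 + sp} {INC (1 + sp)} (notIn-singleton (4 + sp) (1 + sp) (Distinct->1+k+ 2 (1 + sp))) refl)))))
  where
  Pf Pg rest₁ rest₂ rest₃ rest₄ : LoopProg
  Pf = compileExpr (sp ∷ 1 + sp ∷ ρl) (5 + sp) (3 + sp) f
  Pg = compileExpr (sp ∷ 1 + sp ∷ ρl) (5 + sp) (4 + sp) g
  rest₄ = CLR (1 + sp) ⨾ MOV (4 + sp) (1 + sp)
  rest₃ = MOV (3 + sp) sp ⨾ rest₄
  rest₂ = CLR sp ⨾ rest₃
  rest₁ = Pg ⨾ rest₂

compileExpr-wf : ∀ e ρl sp out → Layout ρl sp out → wf (compileExpr ρl sp out e) ≡ true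
compileExpr-wf (var n) ρl sp out g = compileVar-wf ρl sp out n g
compileExpr-wf (lit c) ρl sp out g = refl
compileExpr-wf (sucE e) ρl sp out g = wf-⨾ {compileExpr ρl sp out e} {INC out} (compileExpr-wf e ρl sp out g) refl
compileExpr-wf (predE e) ρl sp out g = wf-⨾ {compileExpr ρl sp out e} {DEC out} (compileExpr-wf e ρl sp out g) refl
compileExpr-wf (addE a b) ρl sp out g = wf-⨾ {compileExpr ρl sp out a} {compileExpr ρl (suc sp) sp b ⨾ MOV sp out} (compileExpr-wf a ρl sp out g)
   (wf-⨾ {compileExpr ρl (suc sp) sp b} {MOV sp out} (compileExpr-wf b ρl (suc sp) sp (layout-scratch (ρ< g) ≤-refl ≤-refl))
   (wf-LOOP {sp} {INC out} (notIn-singleton (sp) (out) (>⇒Distinct (o< g))) refl))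
compileExpr-wf (subE a b) ρl sp out g = wf-⨾ {compileExpr ρl sp out a} {compileExpr ρl (suc sp) sp b ⨾ LOOP sp (DEC out)} (compileExpr-wf a ρl sp out g)
   (wf-⨾ {compileExpr ρl (suc sp) sp b} {LOOP sp (DEC out)} (compileExpr-wf b ρl (suc sp) sp (layout-scratch (ρ< g) ≤-refl ≤-refl))
   (wf-LOOP {sp} {DEC out} (notIn-singleton (sp) (out) (>⇒Distinct (o< g))) refl))
compileExpr-wf (ifz c a b) ρl sp out g =
  wf-⨾ {Pc} {Q1} (compileExpr-wf c ρl (suc sp) sp (layout-scratch (ρ< g) ≤-refl ≤-refl))
  (wf-⨾ {Pb} {Q2} (compileExpr-wf b ρl (suc sp) out (layout-widen g (n≤1+n sp)))
  (wf-⨾ {CLR (suc sp)} {Q3} refl (wf-⨾ {INC (suc sp)} {Q4} refl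
     (wf-⨾ {LOOP sp (CLR (suc sp))} {LOOP (suc sp) Pa} (wf-LOOP {sp} {CLR (suc sp)} (notIn-singleton (sp) (suc sp) (Distinct-<1+k+ 0 sp)) refl)
     (wf-LOOP {suc sp} {Pa} (compileExpr-writes a ρl (2 + sp) out (suc sp) (n<1+k+n 0 (suc sp)) (>⇒Distinct (<-weaken (o< g) 1)) (notIn-above ρl (ρ< g) (n≤1+n sp)))
          (compileExpr-wf a ρl (2 + sp) out (layout-widen g (≤-trans (n≤1+n sp) (n≤1+n (suc sp))))))))))
  where
  Pc = compileExpr ρl (suc sp) sp c
  Pb = compileExpr ρl (suc sp) out b
  Pa = compileExpr ρl (2 + sp) out a
  Q4 = LOOP sp (CLR (suc sp)) ⨾ LOOP (suc sp) Pa
  Q3 = INC (suc sp) ⨾ Q4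
  Q2 = CLR (suc sp) ⨾ Q3
  Q1 = Pb ⨾ Q2
compileExpr-wf (it s n a b f g) ρl sp out gd =
  wf-⨾ {Pa} {T1} (compileExpr-wf a ρl (1 + sp) sp (layout-scratch al ≤-refl ≤-refl))
  (wf-⨾ {Pb} {T2} (compileExpr-wf b ρl (2 + sp) (1 + sp) (layout-scratch al (m≤n+m sp 1) (n<1+k+n 0 (1 + sp))))
  (wf-⨾ {Pn} {T3} (compileExpr-wf n ρl (3 + sp) (2 + sp) (layout-scratch al (m≤n+m sp 2) (n<1+k+n 0 (2 + sp))))
  (wf-⨾ {LOOP (2 + sp) (iterBody sp ρl f g)} {Pend}
     (wf-LOOP {2 + sp} {iterBody sp ρl f g} counter-kept
        (iterBody-wf f g (compileExpr-wf f _ (5 + sp) (3 + sp) (layout-body 0 (s≤s z≤n) al))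
                         (compileExpr-wf g _ (5 + sp) (4 + sp) (layout-body 1 (s≤s (s≤s z≤n)) al))))
  (wf-⨾ {CLR out} {MOV (selectReg s sp (1 + sp)) out} refl
     (wf-LOOP {selectReg s sp (1 + sp)} {INC out} (notIn-singleton (selectReg s sp (1 + sp)) out (selNe s)) refl)))))
  where
  al : All (_< sp) ρl
  al = ρ< gd
  counter-kept : notIn (2 + sp) (writes (iterBody sp ρl f g)) ≡ true
  counter-kept = iterBody-writes f g (compileExpr-writes f) (compileExpr-writes g) (2 + sp) (s≤s (s≤s (n<1+k+n 2 sp)))
    (Distinct->1+k+ 1 sp) (Distinct->1+k+ 0 (1 + sp)) (Distinct-<1+k+ 0 (2 + sp)) (Distinct-<1+k+ 1 (2 + sp)) (notIn-above ρl al (m≤n+m sp 2))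
  selNe : ∀ s → Distinct (selectReg s sp (1 + sp)) out
  selNe true = >⇒Distinct (o< gd)
  selNe false = >⇒Distinct (<-weaken (o< gd) 1)
  Pa Pb Pn Pend T1 T2 T3 : LoopProg
  Pa = compileExpr ρl (1 + sp) sp a
  Pb = compileExpr ρl (2 + sp) (1 + sp) b
  Pn = compileExpr ρl (3 + sp) (2 + sp) n
  Pend = CLR out ⨾ MOV (selectReg s sp (1 + sp)) out
  T3 = LOOP (2 + sp) (iterBody sp ρl f g) ⨾ Pend
  T2 = Pn ⨾ T3
  T1 = Pb ⨾ T2

shift : ℕ → Expr → Expr
shift c (var i) with i <? c
... | yes _ = var i
... | no _ = var (2 + i)
shift c (lit n) = lit n
shift c (sucE e) = sucE (shift c e)
shift c (predE e) = predE (shift c e)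
shift c (addE a b) = addE (shift c a) (shift c b)
shift c (subE a b) = subE (shift c a) (shift c b)
shift c (ifz a b d) = ifz (shift c a) (shift c b) (shift c d)
shift c (it s n a b f g) = it s (shift c n) (shift c a) (shift c b) (shift (2 + c) f) (shift (2 + c) g)

shift-eval : ∀ c e ρ ρ' → (∀ i → i < c → ρ' i ≡ ρ i) → (∀ i → c ≤ i → ρ' (2 + i) ≡ ρ i) → ⟦ shift c e ⟧ ρ' ≡ ⟦ e ⟧ ρ
shift-eval c (var i) ρ ρ' h1 h2 with i <? c
... | yes p = h1 i p
... | no p = h2 i (≮⇒≥ p)
shift-eval c (lit n) ρ ρ' h1 h2 = refl
shift-eval c (sucE e) ρ ρ' h1 h2 = cong suc (shift-eval c e ρ ρ' h1 h2)
shift-eval c (predE e) ρ ρ' h1 h2 = cong predℕ (shift-eval c e ρ ρ' h1 h2)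
shift-eval c (addE a b) ρ ρ' h1 h2 = cong₂ _+_ (shift-eval c a ρ ρ' h1 h2) (shift-eval c b ρ ρ' h1 h2)
shift-eval c (subE a b) ρ ρ' h1 h2 = cong₂ _∸_ (shift-eval c a ρ ρ' h1 h2) (shift-eval c b ρ ρ' h1 h2)
shift-eval c (ifz a b d) ρ ρ' h1 h2 = cong₃ ifZero (shift-eval c a ρ ρ' h1 h2) (shift-eval c b ρ ρ' h1 h2) (shift-eval c d ρ ρ' h1 h2)
shift-eval c (it s n a b f g) ρ ρ' h1 h2 =
  cong (select s) (trans (cong₂ (λ k v → iter k _ v) (shift-eval c n ρ ρ' h1 h2) (cong₂ _,_ (shift-eval c a ρ ρ' h1 h2) (shift-eval c b ρ ρ' h1 h2)))
    (iter-cong _ _ (λ p → cong₂ _,_ (shift-eval (2 + c) f _ _ (e1 p) (e2 p)) (shift-eval (2 + c) g _ _ (e1 p) (e2 p))) (⟦ n ⟧ ρ) (⟦ a ⟧ ρ , ⟦ b ⟧ ρ)))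
  where
  e1 : ∀ p i → i < 2 + c → extend (proj₁ p) (proj₂ p) ρ' i ≡ extend (proj₁ p) (proj₂ p) ρ i
  e1 p zero _ = refl
  e1 p (suc zero) _ = refl
  e1 p (suc (suc i)) (s≤s (s≤s q)) = h1 i q
  e2 : ∀ p i → 2 + c ≤ i → extend (proj₁ p) (proj₂ p) ρ' (2 + i) ≡ extend (proj₁ p) (proj₂ p) ρ i
  e2 p (suc (suc i)) (s≤s (s≤s q)) = h2 i q

weaken₂ : Expr → Expr
weaken₂ = shift 0

weaken₂-eval : ∀ e x y ρ → ⟦ weaken₂ e ⟧ (extend x y ρ) ≡ ⟦ e ⟧ ρ
weaken₂-eval e x y ρ = shift-eval 0 e ρ (extend x y ρ) (λ i ()) (λ i _ → refl)

triangleE : Expr → Expr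
triangleE s = it true s (lit 0) (lit 0) (addE (var 0) (sucE (var 1))) (sucE (var 1))

iter-triangleStep : ∀ n → iter n (λ p → (proj₁ p + suc (proj₂ p) , suc (proj₂ p))) (0 , 0) ≡ (triangle n , n)
iter-triangleStep zero = refl
iter-triangleStep (suc n) = trans (iter-comm _ n (0 , 0)) (cong (λ p → (proj₁ p + suc (proj₂ p) , suc (proj₂ p))) (iter-triangleStep n))

triangleE-eval : ∀ s ρ → ⟦ triangleE s ⟧ ρ ≡ triangle (⟦ s ⟧ ρ)
triangleE-eval s ρ = cong proj₁ (iter-triangleStep (⟦ s ⟧ ρ))

pairE : Expr → Expr → Expr
pairE a b = addE (triangleE (addE a b)) a

pairE-eval : ∀ a b ρ → ⟦ pairE a b ⟧ ρ ≡ pair (⟦ a ⟧ ρ) (⟦ b ⟧ ρ)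
pairE-eval a b ρ = cong (_+ ⟦ a ⟧ ρ) (triangleE-eval (addE a b) ρ)

unpairStep : ℕ × ℕ → ℕ × ℕ
unpairStep p = (ifZero (proj₂ p) 0 (suc (proj₁ p)) , ifZero (proj₂ p) (suc (proj₁ p)) (predℕ (proj₂ p)))

unpairStep≡nextPair : ∀ p → unpairStep p ≡ nextPair p
unpairStep≡nextPair (a , zero) = refl
unpairStep≡nextPair (a , suc b) = refl

iter-unpairStep : ∀ n → iter n unpairStep (0 , 0) ≡ unpair n
iter-unpairStep zero = refl
iter-unpairStep (suc n) = trans (iter-comm unpairStep n (0 , 0)) (trans (unpairStep≡nextPair _) (cong nextPair (iter-unpairStep n)))

unpairE : Bool → Expr → Expr
unpairE s e = it s e (lit 0) (lit 0) (ifz (var 1) (lit 0) (sucE (var 0))) (ifz (var 1) (sucE (var 0)) (predE (var 1)))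

unpair₁E unpair₂E : Expr → Expr
unpair₁E = unpairE true
unpair₂E = unpairE false

unpair₁E-eval : ∀ e ρ → ⟦ unpair₁E e ⟧ ρ ≡ proj₁ (unpair (⟦ e ⟧ ρ))
unpair₁E-eval e ρ = cong proj₁ (iter-unpairStep (⟦ e ⟧ ρ))
unpair₂E-eval : ∀ e ρ → ⟦ unpair₂E e ⟧ ρ ≡ proj₂ (unpair (⟦ e ⟧ ρ))
unpair₂E-eval e ρ = cong proj₂ (iter-unpairStep (⟦ e ⟧ ρ))

dropCodeE : Expr → Expr → Expr
dropCodeE pc e = it true pc e (lit 0) (unpair₂E (predE (var 0))) (lit 0)

iter-dropStep : ∀ n c ρ → proj₁ (iter n (λ p → (⟦ unpair₂E (predE (var 0)) ⟧ (extend (proj₁ p) (proj₂ p) ρ) , 0)) (c , 0)) ≡ dropCode n c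
iter-dropStep zero c ρ = refl
iter-dropStep (suc n) c ρ = trans (cong (λ z → proj₁ (iter n _ (z , 0))) (unpair₂E-eval (predE (var 0)) (extend c 0 ρ))) (iter-dropStep n (tailCode c) ρ)

dropCodeE-eval : ∀ pc e ρ → ⟦ dropCodeE pc e ⟧ ρ ≡ dropCode (⟦ pc ⟧ ρ) (⟦ e ⟧ ρ)
dropCodeE-eval pc e ρ = iter-dropStep (⟦ pc ⟧ ρ) (⟦ e ⟧ ρ) ρ

consRegE : Expr → Expr → Expr → Expr
consRegE r v L = sucE (pairE (pairE r v) L)

consRegE-eval : ∀ r v L ρ → ⟦ consRegE r v L ⟧ ρ ≡ consReg (⟦ r ⟧ ρ) (⟦ v ⟧ ρ) (⟦ L ⟧ ρ)
consRegE-eval r v L ρ = cong suc (trans (pairE-eval (pairE r v) L ρ) (cong (λ z → pair z (⟦ L ⟧ ρ)) (pairE-eval r v ρ)))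

ifEqE : Expr → Expr → Expr → Expr → Expr
ifEqE a b t f = ifz (addE (subE a b) (subE b a)) t f

ifZero-distance : ∀ a b (t f : ℕ) → ifZero ((a ∸ b) + (b ∸ a)) t f ≡ (if a ≡ᵇ b then t else f)
ifZero-distance zero zero t f = refl
ifZero-distance zero (suc b) t f = refl
ifZero-distance (suc a) zero t f = refl
ifZero-distance (suc a) (suc b) t f = ifZero-distance a b t f

ifEqE-eval : ∀ a b t f ρ → ⟦ ifEqE a b t f ⟧ ρ ≡ (if ⟦ a ⟧ ρ ≡ᵇ ⟦ b ⟧ ρ then ⟦ t ⟧ ρ else ⟦ f ⟧ ρ)
ifEqE-eval a b t f ρ = ifZero-distance (⟦ a ⟧ ρ) (⟦ b ⟧ ρ) (⟦ t ⟧ ρ) (⟦ f ⟧ ρ)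

lookupTailE : Expr
lookupTailE = ifz (var 0) (var 0) (ifz (var 1) (unpair₂E (predE (var 0))) (var 0))
lookupHitE : Expr → Expr
lookupHitE r = ifz (var 0) (var 1)
  (ifz (var 1) (ifEqE (weaken₂ r) (unpair₁E (unpair₁E (predE (var 0)))) (sucE (unpair₂E (unpair₁E (predE (var 0))))) (lit 0)) (var 1))

lookupRegE : Expr → Expr → Expr
lookupRegE L r = predE (it false L L (lit 0) lookupTailE (lookupHitE r))

lookupRegE-eval : ∀ L r ρ → ⟦ lookupRegE L r ⟧ ρ ≡ lookupReg (⟦ L ⟧ ρ) (⟦ r ⟧ ρ)
lookupRegE-eval L r ρ = cong (λ p → predℕ (proj₂ p)) (iter-cong _ _ step (⟦ L ⟧ ρ) (⟦ L ⟧ ρ , 0))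
  where
  step : ∀ p → exprStep lookupTailE (lookupHitE r) ρ p ≡ lookupStep (⟦ r ⟧ ρ) p
  step (zero , fv) = refl
  step (suc m , suc fv) = refl
  step (suc m , zero) = cong₂ _,_ (unpair₂E-eval (predE (var 0)) (extend (suc m) 0 ρ))
    (trans (ifEqE-eval (weaken₂ r) (unpair₁E (unpair₁E (predE (var 0)))) (sucE (unpair₂E (unpair₁E (predE (var 0))))) (lit 0) (extend (suc m) 0 ρ))
       (cong₃ (λ u v w → if u ≡ᵇ v then suc w else 0) (weaken₂-eval r (suc m) 0 ρ)
          (trans (unpair₁E-eval (unpair₁E (predE (var 0))) (extend (suc m) 0 ρ)) (cong (λ z → proj₁ (unpair z)) (unpair₁E-eval (predE (var 0)) (extend (suc m) 0 ρ))))
          (trans (unpair₂E-eval (unpair₁E (predE (var 0))) (extend (suc m) 0 ρ)) (cong (λ z → proj₂ (unpair z)) (unpair₁E-eval (predE (var 0)) (extend (suc m) 0 ρ))))))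

module UStepE (E S D : Expr) where
  pcE LE cE mE hE aE bE haltOutE incStateE rE jE vE decStateE nextStateE nextOutE : Expr
  pcE = unpair₁E S
  LE = unpair₂E S
  cE = dropCodeE pcE E
  mE = predE cE
  hE = unpair₁E mE
  aE = unpair₁E hE
  bE = unpair₂E hE
  haltOutE = sucE (lookupRegE LE (lit 0))
  incStateE = pairE (sucE pcE) (consRegE bE (sucE (lookupRegE LE bE)) LE)
  rE = unpair₁E bE
  jE = unpair₂E bE
  vE = lookupRegE LE rE
  decStateE = ifz vE (pairE jE LE) (pairE (sucE pcE) (consRegE rE (predE vE) LE))
  nextStateE = ifz D (ifz cE S (ifz aE incStateE (ifz (predE aE) decStateE S))) S
  nextOutE = ifz D (ifz cE haltOutE (ifz aE (lit 0) (ifz (predE aE) (lit 0) haltOutE))) D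

module UStep (ev sv dv : ℕ) where
  pc L c m h a b haltOut incState r j v decState nextState nextOut : ℕ
  pc = pcOf sv
  L = regsOf sv
  c = dropCode pc ev
  m = predℕ c
  h = proj₁ (unpair m)
  a = proj₁ (unpair h)
  b = proj₂ (unpair h)
  haltOut = suc (lookupReg L 0)
  incState = pair (suc pc) (consReg b (suc (lookupReg L b)) L)
  r = proj₁ (unpair b)
  j = proj₂ (unpair b)
  v = lookupReg L r
  decState = ifZero v (pair j L) (pair (suc pc) (consReg r (predℕ v) L))
  nextState = ifZero dv (ifZero c sv (ifZero a incState (ifZero (predℕ a) decState sv))) sv
  nextOut = ifZero dv (ifZero c haltOut (ifZero a 0 (ifZero (predℕ a) 0 haltOut))) dv

module UStepE-eval (E S D : Expr) (ρ : ℕ → ℕ) where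
  open UStepE E S D
  open UStep (⟦ E ⟧ ρ) (⟦ S ⟧ ρ) (⟦ D ⟧ ρ)
  pc-eval : ⟦ pcE ⟧ ρ ≡ pc
  pc-eval = unpair₁E-eval S ρ
  L-eval : ⟦ LE ⟧ ρ ≡ L
  L-eval = unpair₂E-eval S ρ
  c-eval : ⟦ cE ⟧ ρ ≡ c
  c-eval = trans (dropCodeE-eval pcE E ρ) (cong (λ z → dropCode z (⟦ E ⟧ ρ)) pc-eval)
  h-eval : ⟦ hE ⟧ ρ ≡ h
  h-eval = trans (unpair₁E-eval mE ρ) (cong (λ z → proj₁ (unpair (predℕ z))) c-eval)
  a-eval : ⟦ aE ⟧ ρ ≡ a
  a-eval = trans (unpair₁E-eval hE ρ) (cong (λ z → proj₁ (unpair z)) h-eval)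
  b-eval : ⟦ bE ⟧ ρ ≡ b
  b-eval = trans (unpair₂E-eval hE ρ) (cong (λ z → proj₂ (unpair z)) h-eval)
  lookup-eval : ∀ x y → ⟦ x ⟧ ρ ≡ y → ⟦ lookupRegE LE x ⟧ ρ ≡ lookupReg L y
  lookup-eval x y e = trans (lookupRegE-eval LE x ρ) (cong₂ lookupReg L-eval e)
  haltOut-eval : ⟦ haltOutE ⟧ ρ ≡ haltOut
  haltOut-eval = cong suc (lookup-eval (lit 0) 0 refl)
  incState-eval : ⟦ incStateE ⟧ ρ ≡ incState
  incState-eval = trans (pairE-eval (sucE pcE) (consRegE bE (sucE (lookupRegE LE bE)) LE) ρ) (cong₂ pair (cong suc pc-eval)
     (trans (consRegE-eval bE (sucE (lookupRegE LE bE)) LE ρ) (cong₃ consReg b-eval (cong suc (lookup-eval bE b b-eval)) L-eval)))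
  r-eval : ⟦ rE ⟧ ρ ≡ r
  r-eval = trans (unpair₁E-eval bE ρ) (cong (λ z → proj₁ (unpair z)) b-eval)
  j-eval : ⟦ jE ⟧ ρ ≡ j
  j-eval = trans (unpair₂E-eval bE ρ) (cong (λ z → proj₂ (unpair z)) b-eval)
  v-eval : ⟦ vE ⟧ ρ ≡ v
  v-eval = lookup-eval rE r r-eval
  decState-eval : ⟦ decStateE ⟧ ρ ≡ decState
  decState-eval = cong₃ ifZero v-eval (trans (pairE-eval jE LE ρ) (cong₂ pair j-eval L-eval))
     (trans (pairE-eval (sucE pcE) (consRegE rE (predE vE) LE) ρ) (cong₂ pair (cong suc pc-eval)
        (trans (consRegE-eval rE (predE vE) LE ρ) (cong₃ consReg r-eval (cong predℕ v-eval) L-eval))))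
  nextState-eval : ⟦ nextStateE ⟧ ρ ≡ nextState
  nextState-eval = cong (λ z → ifZero (⟦ D ⟧ ρ) z (⟦ S ⟧ ρ))
     (cong₂ (λ u w → ifZero u (⟦ S ⟧ ρ) w) c-eval (cong₃ (λ u w z → ifZero u w z) a-eval incState-eval
        (cong₂ (λ u w → ifZero u w (⟦ S ⟧ ρ)) (cong predℕ a-eval) decState-eval)))
  nextOut-eval : ⟦ nextOutE ⟧ ρ ≡ nextOut
  nextOut-eval = cong (λ z → ifZero (⟦ D ⟧ ρ) z (⟦ D ⟧ ρ))
     (cong₃ (λ u w z → ifZero u w z) c-eval haltOut-eval (cong₂ (λ u w → ifZero u 0 w) a-eval
        (cong₂ (λ u w → ifZero u 0 w) (cong predℕ a-eval) haltOut-eval)))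

UStep≡ustep : ∀ ev sv dv → (UStep.nextState ev sv dv , UStep.nextOut ev sv dv) ≡ ustep ev (sv , dv)
UStep≡ustep ev sv (suc d) = refl
UStep≡ustep ev sv zero with dropCode (pcOf sv) ev
... | zero = refl
... | suc m' with unpair (proj₁ (unpair m'))
...   | (zero , b) = refl
...   | (suc (suc a) , b) = refl
...   | (suc zero , b) with lookupReg (regsOf sv) (proj₁ (unpair b))
...     | zero = refl
...     | suc v = refl

initRegsCodeE : Expr → Expr
initRegsCodeE x = consRegE (lit 0) x (lit 0)

opaque
  timedRunE : Expr → Expr → Expr → Expr
  timedRunE E x K = it false K (pairE (lit 0) (initRegsCodeE x)) (lit 0)
     (UStepE.nextStateE (weaken₂ E) (var 0) (var 1)) (UStepE.nextOutE (weaken₂ E) (var 0) (var 1))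

  timedRunE-eval : ∀ E x K ρ → ⟦ timedRunE E x K ⟧ ρ ≡ proj₂ (urun (⟦ E ⟧ ρ) (⟦ x ⟧ ρ) (⟦ K ⟧ ρ))
  timedRunE-eval E x K ρ = cong proj₂ (trans (iter-cong F (ustep (⟦ E ⟧ ρ)) stp (⟦ K ⟧ ρ) (⟦ pairE (lit 0) (initRegsCodeE x) ⟧ ρ , 0))
     (cong (λ z → iter (⟦ K ⟧ ρ) (ustep (⟦ E ⟧ ρ)) (z , 0))
       (trans (pairE-eval (lit 0) (initRegsCodeE x) ρ) (cong (pair 0) (consRegE-eval (lit 0) x (lit 0) ρ)))))
    where
    F : ℕ × ℕ → ℕ × ℕ
    F = exprStep (UStepE.nextStateE (weaken₂ E) (var 0) (var 1)) (UStepE.nextOutE (weaken₂ E) (var 0) (var 1)) ρ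
    stp : ∀ p → F p ≡ ustep (⟦ E ⟧ ρ) p
    stp (sv , dv) = trans (cong₂ _,_ (UStepE-eval.nextState-eval (weaken₂ E) (var 0) (var 1) (extend sv dv ρ))
                                      (UStepE-eval.nextOut-eval (weaken₂ E) (var 0) (var 1) (extend sv dv ρ)))
       (trans (cong (λ z → (UStep.nextState z sv dv , UStep.nextOut z sv dv)) (weaken₂-eval E sv dv ρ)) (UStep≡ustep (⟦ E ⟧ ρ) sv dv))

-- timedRun e x k is suc y if machine e halts on x within k steps with output y, and 0 otherwise.
timedRun : ℕ → ℕ → ℕ → ℕ
timedRun e x k = proj₂ (urun e x k)

uresult≡just⇒ : ∀ p y → uresult p ≡ just y → proj₂ p ≡ suc y
uresult≡just⇒ (s , zero) y ()
uresult≡just⇒ (s , suc o) y refl = refl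

uresult-halted : ∀ p y → proj₂ p ≡ suc y → uresult p ≡ just y
uresult-halted (s , zero) y ()
uresult-halted (s , suc o) y refl = refl

Ψ₀⇒timedRun : ∀ {e x y} → Ψ₀ e x y → Σ ℕ λ k → timedRun e x k ≡ suc y
Ψ₀⇒timedRun {e} {x} {y} (k , h) = k , uresult≡just⇒ (urun e x k) y (trans (sym (run≡urun e x k)) h)

timedRun⇒Ψ₀ : ∀ {e x y k} → timedRun e x k ≡ suc y → Ψ₀ e x y
timedRun⇒Ψ₀ {e} {x} {y} {k} h = k , trans (run≡urun e x k) (uresult-halted (urun e x k) y h)

timedRun-mono : ∀ {e x y k k'} → timedRun e x k ≡ suc y → k ≤ k' → timedRun e x k' ≡ suc y
timedRun-mono {e} {x} {y} {k} {k'} h le =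
  uresult≡just⇒ (urun e x k') y (trans (sym (run≡urun e x k'))
    (run-mono≤ (decodeProg e) 0 (initRegs x) y le (trans (run≡urun e x k) (uresult-halted (urun e x k) y h))))

-- Search programs that know their own code

copyInput : List Instr
copyInput = compile 1 (LOOP 0 (INC 2))

loader : LoopProg → ℕ → ℕ → List Instr
loader C z w = compile (11 + size C) (INCS 3 z ⨾ INCS 4 w) ++ (dec 1 1 ∷ [])

searchPrefix : LoopProg → List Instr
searchPrefix C =
  dec 1 (11 + size C) ∷ copyInput ++
  (dec 6 6 ∷ dec 1 (7 + size C) ∷ compile 6 C ++
  (dec 1 4 ∷ compile (7 + size C) (LOOP 7 (INC 0)) ++ (halt ∷ [])))

-- Registers: 0 input and output, 1 the constant 0, 2 the input x, 3 the parameter z,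
-- 4 the datum w, 5 the stage n, 6 the flag, 7 the output.  The program jumps to the
-- loader at its end, which sets z and w and jumps back; it then moves x to register 2
-- and runs the check for n = 0, 1, … until the flag is nonzero, returning register 7.
searchProgram : LoopProg → ℕ → ℕ → Program
searchProgram C z w =
  dec 1 (11 + size C) ∷ copyInput ++
  (dec 6 6 ∷ dec 1 (7 + size C) ∷ compile 6 C ++
  (dec 1 4 ∷ compile (7 + size C) (LOOP 7 (INC 0)) ++
  (halt ∷ compile (11 + size C) (INCS 3 z ⨾ INCS 4 w) ++ (dec 1 1 ∷ []))))

searchProgram-split : ∀ C z w → searchProgram C z w ≡ searchPrefix C ++ loader C z w
searchProgram-split C z w = cong (dec 1 (11 + size C) ∷_) (sym (trans (++-assoc copyInput B1 Ld)
  (cong (copyInput ++_) (cong (λ t → dec 6 6 ∷ dec 1 (7 + size C) ∷ t) (trans (++-assoc (compile 6 C) B2 Ld)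
    (cong (compile 6 C ++_) (cong (dec 1 4 ∷_) (++-assoc L3 (halt ∷ []) Ld))))))))
  where
  L3 Ld B1 B2 : List Instr
  L3 = compile (7 + size C) (LOOP 7 (INC 0))
  Ld = loader C z w
  B2 = dec 1 4 ∷ L3 ++ (halt ∷ [])
  B1 = dec 6 6 ∷ dec 1 (7 + size C) ∷ compile 6 C ++ B2

record IsCheck (C : LoopProg) (FL OV : ℕ → ℕ → ℕ → ℕ → ℕ) : Set where
  field
    well-formed : wf C ≡ true
    keeps-jumpReg : notIn 1 (writes C) ≡ true
    keeps-below5 : ∀ R i → i < 5 → eval C R i ≡ R i
    stage-suc : ∀ R → eval C R 5 ≡ suc (R 5)
    flag-value : ∀ R → eval C R 6 ≡ FL (R 2) (R 3) (R 4) (R 5)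
    output-value : ∀ R → eval C R 7 ≡ OV (R 2) (R 3) (R 4) (R 5)

module SearchRun {C : LoopProg} {FL OV : ℕ → ℕ → ℕ → ℕ → ℕ} (isCheck : IsCheck C FL OV) (z w : ℕ) where
  open IsCheck isCheck

  s : ℕ
  s = size C
  P : Program
  P = searchProgram C z w

  L3 L4 tail10 tail6 tail4 : List Instr
  L3 = compile (7 + s) (LOOP 7 (INC 0))
  L4 = compile (11 + s) (INCS 3 z ⨾ INCS 4 w)
  tail10 = halt ∷ L4 ++ (dec 1 1 ∷ [])
  tail6 = dec 1 4 ∷ L3 ++ tail10
  tail4 = dec 6 6 ∷ dec 1 (7 + s) ∷ compile 6 C ++ tail6

  cP : Contains P 0 P
  cP = mkC λ m x h → h
  c01 : Contains P 1 (copyInput ++ tail4)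
  c01 = contains-tl _ _ cP
  cS1 : Contains P 1 copyInput
  cS1 = contains-++ˡ copyInput tail4 c01
  c4' : Contains P 4 tail4
  c4' = contains-++ʳ copyInput tail4 c01
  n4 : nth P 4 ≡ just (dec 6 6)
  n4 = contains-hd _ _ c4'
  c5 : Contains P 5 (dec 1 (7 + s) ∷ compile 6 C ++ tail6)
  c5 = contains-tl _ _ c4'
  n5 : nth P 5 ≡ just (dec 1 (7 + s))
  n5 = contains-hd _ _ c5
  c6 : Contains P 6 (compile 6 C ++ tail6)
  c6 = contains-tl _ _ c5
  cS2 : Contains P 6 (compile 6 C)
  cS2 = contains-++ˡ (compile 6 C) tail6 c6
  c6s : Contains P (6 + s) tail6
  c6s = subst (λ t → Contains P (6 + t) tail6) (length-compile 6 C) (contains-++ʳ (compile 6 C) tail6 c6)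
  n6s : nth P (6 + s) ≡ just (dec 1 4)
  n6s = contains-hd _ _ c6s
  c7s : Contains P (7 + s) (L3 ++ tail10)
  c7s = contains-tl _ _ c6s
  cS3 : Contains P (7 + s) L3
  cS3 = contains-++ˡ L3 tail10 c7s
  c10s : Contains P (10 + s) tail10
  c10s = subst (λ t → Contains P t tail10) (+-comm (7 + s) 3) (contains-++ʳ L3 tail10 c7s)
  n10s : nth P (10 + s) ≡ just halt
  n10s = contains-hd _ _ c10s
  c11s : Contains P (11 + s) (L4 ++ (dec 1 1 ∷ []))
  c11s = contains-tl _ _ c10s
  cS4 : Contains P (11 + s) L4
  cS4 = contains-++ˡ L4 (dec 1 1 ∷ []) c11s
  nL : nth P (11 + s + (z + w)) ≡ just (dec 1 1)
  nL = contains-hd _ _ (subst (λ t → Contains P (11 + s + t) (dec 1 1 ∷ [])) (length-compile (11 + s) (INCS 3 z ⨾ INCS 4 w))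
         (contains-++ʳ L4 (dec 1 1 ∷ []) c11s))

  record Inv (x n : ℕ) (S : ℕ → ℕ) : Set where
    field
      i0 : S 0 ≡ 0
      i1 : S 1 ≡ 0
      i2 : S 2 ≡ x
      i3 : S 3 ≡ z
      i4 : S 4 ≡ w
      i5 : S 5 ≡ n
      i6 : S 6 ≡ 0
  open Inv

  check-round : ∀ x n S → Inv x n S →
    Reach P 4 S (6 + s) (eval C S) × (eval C S 6 ≡ FL x z w n) × (eval C S 7 ≡ OV x z w n)
  check-round x n S iv =
    reach-trans (reach-step (λ f → run-decz f P 4 S 6 6 n4 (i6 iv)))
      (compile-correct C P 6 cS2 well-formed S (i1 iv) keeps-jumpReg)
    , trans (flag-value S) (cong₃' (i2 iv) (i3 iv) (i4 iv) (i5 iv))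
    , trans (output-value S) (cong₃'' (i2 iv) (i3 iv) (i4 iv) (i5 iv))
    where
    cong₃' : ∀ {a b c d} → a ≡ x → b ≡ z → c ≡ w → d ≡ n → FL a b c d ≡ FL x z w n
    cong₃' refl refl refl refl = refl
    cong₃'' : ∀ {a b c d} → a ≡ x → b ≡ z → c ≡ w → d ≡ n → OV a b c d ≡ OV x z w n
    cong₃'' refl refl refl refl = refl

  afterCheck : (ℕ → ℕ) → (ℕ → ℕ)
  afterCheck S = eval C S

  inv-suc : ∀ x n S → Inv x n S → FL x z w n ≡ 0 → Inv x (suc n) (afterCheck S)
  inv-suc x n S iv e = record
    { i0 = trans (keeps-below5 S 0 (s≤s z≤n)) (i0 iv) ; i1 = trans (eval-frame C S 1 keeps-jumpReg) (i1 iv)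
    ; i2 = trans (keeps-below5 S 2 (s≤s (s≤s (s≤s z≤n)))) (i2 iv) ; i3 = trans (keeps-below5 S 3 (s≤s (s≤s (s≤s (s≤s z≤n))))) (i3 iv)
    ; i4 = trans (keeps-below5 S 4 (s≤s (s≤s (s≤s (s≤s (s≤s z≤n)))))) (i4 iv) ; i5 = trans (stage-suc S) (cong suc (i5 iv))
    ; i6 = trans (proj₁ (proj₂ (check-round x n S iv))) e }

  loop-round : ∀ x n S → (iv : Inv x n S) → FL x z w n ≡ 0 →
    Σ ℕ λ k → ∀ f → run (suc k + f) P 4 S ≡ run f P 4 (afterCheck S)
  loop-round x n S iv e = kc + 1 , λ f → trans (cong (λ t → run t P 4 S) (cong suc (+-assoc kc 1 f)))
         (trans (proj₂ (proj₁ (check-round x n S iv)) (1 + f)) (run-decz f P (6 + s) (afterCheck S) 1 4 n6s (trans (eval-frame C S 1 keeps-jumpReg) (i1 iv))))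
    where
    kc = proj₁ (compile-correct C P 6 cS2 well-formed S (i1 iv) keeps-jumpReg)

  afterOutput : (ℕ → ℕ) → ℕ → (ℕ → ℕ)
  afterOutput S m = eval (LOOP 7 (INC 0)) (setReg (afterCheck S) 6 m)

  halt-run : ∀ x n S → (iv : Inv x n S) → ∀ m → FL x z w n ≡ suc m →
    Σ ℕ λ k → run k P 4 S ≡ just (OV x z w n)
  halt-run x n S iv m e with proj₁ (check-round x n S iv)
  ... | (k1 , h1) with compile-correct (LOOP 7 (INC 0)) P (7 + s) cS3 refl (setReg (afterCheck S) 6 m)
            (trans (eval-frame C S 1 keeps-jumpReg) (i1 iv)) refl
  ...   | (k3 , h3) = k1 + (1 + (1 + (1 + (k3 + 1)))) , chain
    where
    T1 = afterCheck S
    T2 = setReg T1 6 m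
    f6 : T1 6 ≡ suc m
    f6 = trans (proj₁ (proj₂ (check-round x n S iv))) e
    out0 : afterOutput S m 0 ≡ OV x z w n
    out0 = trans (MOV-adds 7 0 refl T2) (trans (cong₂ _+_ (proj₂ (proj₂ (check-round x n S iv)))
             (trans (keeps-below5 S 0 (s≤s z≤n)) (i0 iv))) (+-identityʳ _))
    chain : run (k1 + (1 + (1 + (1 + (k3 + 1))))) P 4 S ≡ just (OV x z w n)
    chain = trans (h1 (1 + (1 + (1 + (k3 + 1)))))
      (trans (run-decz (1 + (1 + (k3 + 1))) P (6 + s) T1 1 4 n6s (trans (eval-frame C S 1 keeps-jumpReg) (i1 iv)))
      (trans (run-decs (1 + (k3 + 1)) P 4 T1 6 6 m n4 f6)
      (trans (run-decz (k3 + 1) P 5 T2 1 (7 + s) n5 (trans (eval-frame C S 1 keeps-jumpReg) (i1 iv)))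
      (trans (h3 1)
      (trans (subst (λ t → run 1 P t (afterOutput S m) ≡ just (afterOutput S m 0)) (sym (+-comm (7 + s) 3))
                (run-halt 0 P (10 + s) (afterOutput S m) n10s))
             (cong just out0))))))

  LD : LoopProg
  LD = INCS 3 z ⨾ INCS 4 w
  loaded : ℕ → (ℕ → ℕ)
  loaded x = eval LD (initRegs x)
  started : ℕ → (ℕ → ℕ)
  started x = eval (LOOP 0 (INC 2)) (loaded x)

  loaded-param : ∀ x → loaded x 3 ≡ z
  loaded-param x = trans (addReg-frame 4 w _ 3 refl) (trans (addReg-value 3 z (initRegs x)) (+-identityʳ z))
  loaded-datum : ∀ x → loaded x 4 ≡ w
  loaded-datum x = trans (addReg-value 4 w _) (trans (cong (w +_) (addReg-frame 3 z (initRegs x) 4 refl)) (+-identityʳ w))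

  reach-start : ∀ x → Reach P 0 (initRegs x) 4 (started x)
  reach-start x =
    reach-trans (reach-step (λ f → run-decz f P 0 (initRegs x) 1 (11 + s) refl refl))
    (reach-trans (compile-correct LD P (11 + s) cS4 refl (initRegs x) refl refl)
    (reach-trans (reach-step (λ f → run-decz f P (11 + s + (z + w)) (loaded x) 1 1 nL (eval-frame LD (initRegs x) 1 refl)))
      (compile-correct (LOOP 0 (INC 2)) P 1 cS1 refl (loaded x) (eval-frame LD (initRegs x) 1 refl) refl)))

  inv-start : ∀ x → Inv x 0 (started x)
  inv-start x = record
    { i0 = iterLoop-counter 0 (INC 2) refl (loaded x 0) (loaded x) refl
    ; i1 = trans (eval-frame (LOOP 0 (INC 2)) (loaded x) 1 refl) (eval-frame LD (initRegs x) 1 refl)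
    ; i2 = trans (MOV-adds 0 2 refl (loaded x)) (trans (cong₂ _+_ (eval-frame LD (initRegs x) 0 refl) (eval-frame LD (initRegs x) 2 refl)) (+-identityʳ x))
    ; i3 = trans (eval-frame (LOOP 0 (INC 2)) (loaded x) 3 refl) (loaded-param x)
    ; i4 = trans (eval-frame (LOOP 0 (INC 2)) (loaded x) 4 refl) (loaded-datum x)
    ; i5 = trans (eval-frame (LOOP 0 (INC 2)) (loaded x) 5 refl) (eval-frame LD (initRegs x) 5 refl)
    ; i6 = trans (eval-frame (LOOP 0 (INC 2)) (loaded x) 6 refl) (eval-frame LD (initRegs x) 6 refl) }

  halts-ifFlag : ∀ d x n S → Inv x n S → (Σ ℕ λ m → FL x z w (d + n) ≡ suc m) →
    Σ ℕ λ y → Σ ℕ λ k → run k P 4 S ≡ just y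
  halts-ifFlag d x n S iv (m , e) with FL x z w n in eq
  ... | suc m' = OV x z w n , halt-run x n S iv m' eq
  halts-ifFlag zero x n S iv (m , e) | zero with trans (sym eq) e
  ... | ()
  halts-ifFlag (suc d) x n S iv (m , e) | zero with loop-round x n S iv eq
  ... | (k , hk) with halts-ifFlag d x (suc n) (afterCheck S) (inv-suc x n S iv eq) (m , trans (cong (FL x z w) (+-suc d n)) e)
  ...   | (y , k2 , h2) = y , suc k + k2 , trans (hk k2) h2

  flag-ifHalts : ∀ B x n S K y → K ≤ B → Inv x n S → run K P 4 S ≡ just y →
    Σ ℕ λ n' → Σ ℕ λ m → (FL x z w n' ≡ suc m) × (y ≡ OV x z w n')
  flag-ifHalts B x n S K y le iv h with FL x z w n in eq
  ... | suc m = n , m , eq , run-deterministic {K} {proj₁ (halt-run x n S iv m eq)} {P} {4} {S} h (proj₂ (halt-run x n S iv m eq))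
  ... | zero with loop-round x n S iv eq
  ...   | (k , hk) with suc k ≤? K
  ...     | no nle = ⊥-elim (nothing≢just (trans (sym (hk 0)) (trans (cong (λ t → run t P 4 S) (+-identityʳ (suc k)))
                 (run-mono≤ P 4 S y (<⇒≤ (≰⇒> nle)) h))))
    where
    nothing≢just : ∀ {a : ℕ} → nothing ≢ just a
    nothing≢just ()
  ...     | yes sle = rec B le
    where
    f = K ∸ suc k
    Keq : suc k + f ≡ K
    Keq = trans (+-comm (suc k) f) (m∸n+n≡m sle)
    hf : run f P 4 (afterCheck S) ≡ just y
    hf = trans (sym (hk f)) (trans (cong (λ t → run t P 4 S) Keq) h)
    rec : ∀ B → K ≤ B → Σ ℕ λ n' → Σ ℕ λ m → (FL x z w n' ≡ suc m) × (y ≡ OV x z w n')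
    rec zero kb = ⊥-elim (1+n≰n (≤-trans sle (≤-trans kb z≤n)))
    rec (suc B') kb = flag-ifHalts B' x (suc n) (afterCheck S) f y
      (≤-pred (≤-trans (s≤s (m≤n+m f k)) (≤-trans (≤-reflexive Keq) kb)))
      (inv-suc x n S iv eq) hf

  search-halts : ∀ e x → decodeProg e ≡ P → (Σ ℕ λ n → Σ ℕ λ m → FL x z w n ≡ suc m) → Σ ℕ λ y → Ψ₀ e x y
  search-halts e x de (n , m , eq) with halts-ifFlag n x 0 (started x) (inv-start x) (m , trans (cong (FL x z w) (+-identityʳ n)) eq) | reach-start x
  ... | (y , k , h) | (k0 , h0) = y , k0 + k ,
      trans (cong (λ p → run (k0 + k) p 0 (initRegs x)) de) (trans (h0 k) h)

  search-sound : ∀ e x y → decodeProg e ≡ P → Ψ₀ e x y → Σ ℕ λ n → Σ ℕ λ m → (FL x z w n ≡ suc m) × (y ≡ OV x z w n)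
  search-sound e x y de (K , h) with reach-start x
  ... | (k0 , h0) = flag-ifHalts K x 0 (started x) K y ≤-refl (inv-start x)
      (trans (sym (h0 K)) (run-mono+ k0 K P 0 (initRegs x) y
         (trans (cong (λ p → run K p 0 (initRegs x)) (sym de)) h)))

length≤codeProg : ∀ xs → length xs ≤ codeProg xs
length≤codeProg [] = z≤n
length≤codeProg (x ∷ xs) rewrite codeProg-∷ x xs = s≤s (≤-trans (length≤codeProg xs) (pair-≥ʳ (codeInstr x) (codeProg xs)))

revAppendStep : ℕ × ℕ → ℕ × ℕ
revAppendStep (zero , a) = (zero , a)
revAppendStep (suc m , a) = (proj₂ (unpair m) , suc (pair (proj₁ (unpair m)) a))

iter-revAppendStep : ∀ rs n ys → length rs ≤ n → proj₂ (iter n revAppendStep (codeProg rs , codeProg ys)) ≡ codeProg (rs ʳ++ ys)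
iter-revAppendStep [] n ys le rewrite codeProg-[] = cong proj₂ (iter-fix revAppendStep (0 , codeProg ys) refl n)
iter-revAppendStep (r ∷ rs) (suc n) ys (s≤s le) rewrite codeProg-∷ r rs | unpair-pair (codeInstr r) (codeProg rs) | sym (codeProg-∷ r ys) = iter-revAppendStep rs n (r ∷ ys) le

consCode : ℕ → ℕ → ℕ
consCode c a = suc (pair c a)

codeProg-replicate : ∀ i z ys → codeProg (replicate z i ++ ys) ≡ iter z (consCode (codeInstr i)) (codeProg ys)
codeProg-replicate i zero ys = refl
codeProg-replicate i (suc z) ys = begin
  codeProg (i ∷ replicate z i ++ ys)                  ≡⟨ codeProg-∷ i (replicate z i ++ ys) ⟩
  cons (codeProg (replicate z i ++ ys))               ≡⟨ cong cons (codeProg-replicate i z ys) ⟩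
  cons (iter z cons (codeProg ys))                    ≡⟨ sym (iter-comm cons z (codeProg ys)) ⟩
  iter (suc z) cons (codeProg ys)                     ∎
  where
  open ≡-Reasoning
  cons : ℕ → ℕ
  cons = consCode (codeInstr i)

loadParams : ℕ → ℕ → List Instr
loadParams z w = (replicate z (inc 3) ++ replicate w (inc 4)) ++ (dec 1 1 ∷ [])

codeProg-loadParams : ∀ z w → codeProg (loadParams z w) ≡ iter z (consCode (codeInstr (inc 3))) (iter w (consCode (codeInstr (inc 4))) (codeProg (dec 1 1 ∷ [])))
codeProg-loadParams z w = trans (cong codeProg (++-assoc (replicate z (inc 3)) _ _))
  (trans (codeProg-replicate (inc 3) z _) (cong (iter z (consCode (codeInstr (inc 3)))) (codeProg-replicate (inc 4) w _)))

consCodeE : ℕ → Expr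
consCodeE c = sucE (pairE (lit c) (var 0))

iter-consCodeE : ∀ c n a ρ → proj₁ (iter n (exprStep (consCodeE c) (lit 0) ρ) (a , 0)) ≡ iter n (consCode c) a
iter-consCodeE c zero a ρ = refl
iter-consCodeE c (suc n) a ρ = trans (cong (λ t → proj₁ (iter n (exprStep (consCodeE c) (lit 0) ρ) (t , 0))) (cong suc (pairE-eval (lit c) (var 0) (extend a 0 ρ)))) (iter-consCodeE c n (consCode c a) ρ)

loadParamsCodeE : Expr → Expr → Expr
loadParamsCodeE Z W = it true Z (it true W (lit (codeProg (dec 1 1 ∷ []))) (lit 0) (consCodeE (codeInstr (inc 4))) (lit 0)) (lit 0) (consCodeE (codeInstr (inc 3))) (lit 0)

loadParamsCodeE-eval : ∀ Z W ρ → ⟦ loadParamsCodeE Z W ⟧ ρ ≡ codeProg (loadParams (⟦ Z ⟧ ρ) (⟦ W ⟧ ρ))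
loadParamsCodeE-eval Z W ρ = begin
  ⟦ loadParamsCodeE Z W ⟧ ρ
    ≡⟨ cong (λ t → proj₁ (iter (⟦ Z ⟧ ρ) (exprStep (consCodeE (codeInstr (inc 3))) (lit 0) ρ) (t , 0)))
            (iter-consCodeE (codeInstr (inc 4)) (⟦ W ⟧ ρ) (codeProg (dec 1 1 ∷ [])) ρ) ⟩
  proj₁ (iter (⟦ Z ⟧ ρ) (exprStep (consCodeE (codeInstr (inc 3))) (lit 0) ρ) (tail , 0))
    ≡⟨ iter-consCodeE (codeInstr (inc 3)) (⟦ Z ⟧ ρ) tail ρ ⟩
  iter (⟦ Z ⟧ ρ) (consCode (codeInstr (inc 3))) tail
    ≡⟨ sym (codeProg-loadParams (⟦ Z ⟧ ρ) (⟦ W ⟧ ρ)) ⟩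
  codeProg (loadParams (⟦ Z ⟧ ρ) (⟦ W ⟧ ρ)) ∎
  where
  open ≡-Reasoning
  tail : ℕ
  tail = iter (⟦ W ⟧ ρ) (consCode (codeInstr (inc 4))) (codeProg (dec 1 1 ∷ []))

revAppendTailE revAppendAccE : Expr
revAppendTailE = ifz (var 0) (var 0) (unpair₂E (predE (var 0)))
revAppendAccE = ifz (var 0) (var 1) (sucE (pairE (unpair₁E (predE (var 0))) (var 1)))

revAppendE : Expr → Expr → Expr
revAppendE W A = it false W W A revAppendTailE revAppendAccE

revAppendE-eval : ∀ W A ρ → ⟦ revAppendE W A ⟧ ρ ≡ proj₂ (iter (⟦ W ⟧ ρ) revAppendStep (⟦ W ⟧ ρ , ⟦ A ⟧ ρ))
revAppendE-eval W A ρ = cong proj₂ (iter-cong _ _ step (⟦ W ⟧ ρ) _)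
  where
  step : ∀ p → exprStep revAppendTailE revAppendAccE ρ p ≡ revAppendStep p
  step (zero , a) = refl
  step (suc m , a) = cong₂ _,_ (unpair₂E-eval (predE (var 0)) (extend (suc m) a ρ))
     (cong suc (trans (pairE-eval (unpair₁E (predE (var 0))) (var 1) (extend (suc m) a ρ))
        (cong (λ t → pair t a) (unpair₁E-eval (predE (var 0)) (extend (suc m) a ρ)))))

-- W serves as the bound of the reverse-append loop: a code exceeds the length of its list.
opaque
  selfCodeE : Expr → Expr → Expr
  selfCodeE Z W = revAppendE W (loadParamsCodeE Z W)

  selfCodeE-eval : ∀ P0 Z W ρ → ⟦ W ⟧ ρ ≡ codeProg (reverse P0) → ⟦ selfCodeE Z W ⟧ ρ ≡ codeProg (P0 ++ loadParams (⟦ Z ⟧ ρ) (⟦ W ⟧ ρ))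
  selfCodeE-eval P0 Z W ρ e = begin
    ⟦ selfCodeE Z W ⟧ ρ
      ≡⟨ revAppendE-eval W (loadParamsCodeE Z W) ρ ⟩
    proj₂ (iter (⟦ W ⟧ ρ) revAppendStep (⟦ W ⟧ ρ , ⟦ loadParamsCodeE Z W ⟧ ρ))
      ≡⟨ cong₂ (λ u v → proj₂ (iter u revAppendStep (u , v))) e (loadParamsCodeE-eval Z W ρ) ⟩
    proj₂ (iter (codeProg (reverse P0)) revAppendStep (codeProg (reverse P0) , codeProg loaded))
      ≡⟨ iter-revAppendStep (reverse P0) (codeProg (reverse P0)) loaded (length≤codeProg (reverse P0)) ⟩
    codeProg (reverse P0 ʳ++ loaded)
      ≡⟨ cong codeProg (trans (ʳ++-defn (reverse P0)) (cong (_++ loaded) (reverse-involutive P0))) ⟩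
    codeProg (P0 ++ loaded) ∎
    where
    open ≡-Reasoning
    loaded : List Instr
    loaded = loadParams (⟦ Z ⟧ ρ) (⟦ W ⟧ ρ)

checkEnv : List ℕ
checkEnv = 2 ∷ 3 ∷ 4 ∷ 5 ∷ []

checkProg : Expr → Expr → LoopProg
checkProg fl ov = compileExpr checkEnv 8 6 fl ⨾ compileExpr checkEnv 8 7 ov ⨾ INC 5

searchEnv : ℕ → ℕ → ℕ → ℕ → ℕ → ℕ
searchEnv a b c d zero = a
searchEnv a b c d (suc zero) = b
searchEnv a b c d (suc (suc zero)) = c
searchEnv a b c d (suc (suc (suc zero))) = d
searchEnv a b c d (suc (suc (suc (suc _)))) = 0

evalAt : Expr → ℕ → ℕ → ℕ → ℕ → ℕ
evalAt e a b c d = ⟦ e ⟧ (searchEnv a b c d)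

envOf-checkEnv : ∀ R i → envOf checkEnv R i ≡ searchEnv (R 2) (R 3) (R 4) (R 5) i
envOf-checkEnv R zero = refl
envOf-checkEnv R (suc zero) = refl
envOf-checkEnv R (suc (suc zero)) = refl
envOf-checkEnv R (suc (suc (suc zero))) = refl
envOf-checkEnv R (suc (suc (suc (suc i)))) = refl

checkEnv<8 : All (_< 8) checkEnv
checkEnv<8 = <ᵇ⇒< 2 8 tt ∷ <ᵇ⇒< 3 8 tt ∷ <ᵇ⇒< 4 8 tt ∷ <ᵇ⇒< 5 8 tt ∷ []

layout6 : Layout checkEnv 8 6
layout6 = layout checkEnv<8 (<ᵇ⇒< 6 8 tt) (refl ∷ refl ∷ refl ∷ refl ∷ [])
layout7 : Layout checkEnv 8 7
layout7 = layout checkEnv<8 (<ᵇ⇒< 7 8 tt) (refl ∷ refl ∷ refl ∷ refl ∷ [])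

checkProg-isCheck : ∀ fl ov → IsCheck (checkProg fl ov) (evalAt fl) (evalAt ov)
checkProg-isCheck fl ov = record
  { well-formed = wf-⨾ {flagProg} {outputProg ⨾ INC 5} (compileExpr-wf fl checkEnv 8 6 layout6)
                       (wf-⨾ {outputProg} {INC 5} (compileExpr-wf ov checkEnv 8 7 layout7) refl)
  ; keeps-jumpReg = notIn-⨾ 1 flagProg (outputProg ⨾ INC 5) (compileExpr-writes fl checkEnv 8 6 1 (s≤s (s≤s z≤n)) refl refl)
                      (notIn-⨾ 1 outputProg (INC 5) (compileExpr-writes ov checkEnv 8 7 1 (s≤s (s≤s z≤n)) refl refl) refl)
  ; keeps-below5 = λ R i i<5 →
      let i<8 = ≤-trans i<5 (≤ᵇ⇒≤ 5 8 tt) in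
      trans (setReg-ne (S₂ R) 5 _ i (<⇒Distinct i<5))
        (trans (compileExpr-frame ov checkEnv 8 7 layout7 (S₁ R) i i<8 (<⇒Distinct (≤-trans i<5 (≤ᵇ⇒≤ 5 7 tt))))
               (compileExpr-frame fl checkEnv 8 6 layout6 R i i<8 (<⇒Distinct (≤-trans i<5 (≤ᵇ⇒≤ 5 6 tt)))))
  ; stage-suc = λ R → trans (setReg-eq (S₂ R) 5 _)
      (cong suc (trans (compileExpr-frame ov checkEnv 8 7 layout7 (S₁ R) 5 (<ᵇ⇒< 5 8 tt) refl)
                       (compileExpr-frame fl checkEnv 8 6 layout6 R 5 (<ᵇ⇒< 5 8 tt) refl)))
  ; flag-value = λ R → trans (compileExpr-frame ov checkEnv 8 7 layout7 (S₁ R) 6 (<ᵇ⇒< 6 8 tt) refl)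
      (trans (compileExpr-value fl checkEnv 8 6 layout6 R) (⟦⟧-cong fl _ _ (envOf-checkEnv R)))
  ; output-value = λ R → trans (compileExpr-value ov checkEnv 8 7 layout7 (S₁ R))
      (trans (⟦⟧-cong ov _ _ (envOf-agree checkEnv 6 (S₁ R) R (<ᵇ⇒< 2 6 tt ∷ <ᵇ⇒< 3 6 tt ∷ <ᵇ⇒< 4 6 tt ∷ <ᵇ⇒< 5 6 tt ∷ [])
               (λ i i<6 → compileExpr-frame fl checkEnv 8 6 layout6 R i (≤-trans i<6 (≤ᵇ⇒≤ 6 8 tt)) (<⇒Distinct i<6))))
             (⟦⟧-cong ov _ _ (envOf-checkEnv R)))
  }
  where
  flagProg outputProg : LoopProg
  flagProg = compileExpr checkEnv 8 6 fl
  outputProg = compileExpr checkEnv 8 7 ov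
  S₁ S₂ : (ℕ → ℕ) → (ℕ → ℕ)
  S₁ R = eval flagProg R
  S₂ R = eval outputProg (S₁ R)

-- The stage is read as a pair (candidate sibling, time bound).
candidateE timeE : Expr
candidateE = unpair₁E (var 3)
timeE = unpair₂E (var 3)

siblingRunE : ℕ → Expr
siblingRunE e = timedRunE (lit e) (selfCodeE candidateE (var 2)) timeE

module Search (fl ov : Expr) where
  opaque
    check : LoopProg
    check = checkProg fl ov

    check-isCheck : IsCheck check (evalAt fl) (evalAt ov)
    check-isCheck = checkProg-isCheck fl ov

  opaque
    selfDatum : ℕ
    selfDatum = codeProg (reverse (searchPrefix check))

    code : ℕ → ℕ → ℕ
    code z w = codeProg (searchProgram check z w)

    decode-code : ∀ z w → decodeProg (code z w) ≡ searchProgram check z w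
    decode-code z w = decodeProg-codeProg (searchProgram check z w)

    selfCode-eval : ∀ Z W ρ → ⟦ W ⟧ ρ ≡ selfDatum → ⟦ selfCodeE Z W ⟧ ρ ≡ code (⟦ Z ⟧ ρ) (⟦ W ⟧ ρ)
    selfCode-eval Z W ρ e = trans (selfCodeE-eval (searchPrefix check) Z W ρ e) (cong codeProg (sym (searchProgram-split check (⟦ Z ⟧ ρ) (⟦ W ⟧ ρ))))

  siblingRun-eval : ∀ e x z n →
    evalAt (siblingRunE e) x z selfDatum n ≡ timedRun e (code (proj₁ (unpair n)) selfDatum) (proj₂ (unpair n))
  siblingRun-eval e x z n = trans (timedRunE-eval (lit e) (selfCodeE candidateE (var 2)) timeE ρ)
    (cong₂ (timedRun e) (trans (selfCode-eval candidateE (var 2) ρ refl) (cong (λ c → code c selfDatum) (unpair₁E-eval (var 3) ρ)))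
                  (unpair₂E-eval (var 3) ρ))
    where
    ρ : ℕ → ℕ
    ρ = searchEnv x z selfDatum n

  halts : ∀ z w x → (Σ ℕ λ n → Σ ℕ λ m → evalAt fl x z w n ≡ suc m) → ∃ (Ψ₀ (code z w) x)
  halts z w x = SearchRun.search-halts check-isCheck z w (code z w) x (decode-code z w)

  sound : ∀ {z w x v} → Ψ₀ (code z w) x v →
    Σ ℕ λ n → Σ ℕ λ m → (evalAt fl x z w n ≡ suc m) × (v ≡ evalAt ov x z w n)
  sound {z} {w} {x} {v} = SearchRun.search-sound check-isCheck z w (code z w) x v (decode-code z w)

module WithAcceptable (Φ : Numbering) {f g : ℕ → ℕ}
  (f-computable : TotalComputable f) (g-computable : TotalComputable g)
  (toΨ₀ : ∀ e x y → Φ e x y ⇔ Ψ₀ (f e) x y) (fromΨ₀ : ∀ e x y → Ψ₀ e x y ⇔ Φ (g e) x y) where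

  ef eg : ℕ
  ef = proj₁ f-computable
  eg = proj₁ g-computable

  W-g : ∀ e x → W Φ (g e) x ⇔ ∃ (Ψ₀ e x)
  W-g e x = mk⇔ (λ (v , φ) → v , Equivalence.from (fromΨ₀ e x v) φ) (λ (v , ψ) → v , Equivalence.to (fromΨ₀ e x v) ψ)

  timedRun-g : ∀ {x G k} → timedRun eg x k ≡ suc G → G ≡ g x
  timedRun-g {x} {G} {k} h = Ψ₀-functional (timedRun⇒Ψ₀ {eg} {x} {G} {k} h) (proj₂ g-computable x)

  module SearchFamily (flagE : Expr) where
    open Search flagE (var 1) public

    member : ℕ → ℕ
    member z = g (code z selfDatum)

    member-output : ∀ z y v → Φ (member z) y v → v ≡ z
    member-output z y v φ = proj₂ (proj₂ (proj₂ (sound (Equivalence.from (fromΨ₀ _ y v) φ))))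

    member-domain : ∀ {S : ℕ → Set} (flag : ℕ → ℕ → ℕ) → (∀ y z n → evalAt flagE y z selfDatum n ≡ flag y n) →
      (∀ y n m → flag y n ≡ suc m → S y) → (∀ y → S y → Σ ℕ λ n → Σ ℕ λ m → flag y n ≡ suc m) →
      ∀ z y → W Φ (member z) y ⇔ S y
    member-domain flag flag-eval flag-sound flag-complete z y = mk⇔
      (λ w → let (_ , ψ) = Equivalence.to (W-g _ y) w
                 (n , m , flag≡ , _) = sound ψ
             in flag-sound y n m (trans (sym (flag-eval y z n)) flag≡))
      (λ s → let (n , m , flag≡) = flag-complete y s
             in Equivalence.from (W-g _ y) (halts z selfDatum y (n , m , trans (flag-eval y z n) flag≡)))

  module FiniteFamily (N : ℕ) where
    flagE : Expr
    flagE = ifz (siblingRunE eg) (lit 0)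
      (ifz (subE (sucE candidateE) (lit N)) (ifEqE (var 0) (predE (siblingRunE eg)) (lit 1) (lit 0)) (lit 0))

    open SearchFamily flagE

    gRun : ℕ → ℕ
    gRun n = timedRun eg (code (proj₁ (unpair n)) selfDatum) (proj₂ (unpair n))

    flag : ℕ → ℕ → ℕ
    flag y n = ifZero (gRun n) 0 (ifZero (suc (proj₁ (unpair n)) ∸ N) (if y ≡ᵇ predℕ (gRun n) then 1 else 0) 0)

    flagE-eval : ∀ y z n → evalAt flagE y z selfDatum n ≡ flag y n
    flagE-eval y z n =
      cong₃ (λ a b c → ifZero a 0 (ifZero b c 0)) (siblingRun-eval eg y z n) (cong (λ t → suc t ∸ N) (unpair₁E-eval (var 3) ρ))
        (trans (ifEqE-eval (var 0) (predE (siblingRunE eg)) (lit 1) (lit 0) ρ)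
               (cong (λ t → if y ≡ᵇ predℕ t then 1 else 0) (siblingRun-eval eg y z n)))
      where
      ρ : ℕ → ℕ
      ρ = searchEnv y z selfDatum n

    flag-sound : ∀ y n m → flag y n ≡ suc m → Image member (_< N) y
    flag-sound y n m = accept (gRun n) refl (suc (proj₁ (unpair n)) ∸ N) refl
      where
      accept : ∀ G → gRun n ≡ G → ∀ b → suc (proj₁ (unpair n)) ∸ N ≡ b →
        ifZero G 0 (ifZero b (if y ≡ᵇ predℕ G then 1 else 0) 0) ≡ suc m → Image member (_< N) y
      accept (suc G) run≡ zero bound≡ h =
        proj₁ (unpair n) , m∸n≡0⇒m≤n bound≡ ,
        trans (≡ᵇ≡true⇒≡ y G (if1else0≡suc⇒true h)) (timedRun-g {code (proj₁ (unpair n)) selfDatum} {G} {proj₂ (unpair n)} run≡)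

    flag-complete : ∀ y → Image member (_< N) y → Σ ℕ λ n → Σ ℕ λ m → flag y n ≡ suc m
    flag-complete y (z' , z'<N , refl) with Ψ₀⇒timedRun (proj₂ g-computable (code z' selfDatum))
    ... | k , halted = pair z' k , 0 , accepted
      where
      accepted : flag (member z') (pair z' k) ≡ 1
      accepted rewrite unpair-pair z' k | halted | m≤n⇒m∸n≡0 z'<N | ≡ᵇ-refl (member z') = refl

    domain : ∀ z y → W Φ (member z) y ⇔ Image member (_< N) y
    domain = member-domain flag flagE-eval flag-sound flag-complete

    selfConstructing : 1 ≤ N → Σ (ℕ → Set) λ A → SelfConstructing Φ A × HasCardinality A N
    selfConstructing N≥1 =
      Image member (_< N) , selfConstructing-image member domain (0 , N≥1) ,
      image-<-cardinality member
        (injective-ifOutputIsIndex {Φ} member member-output (λ z → member 0 , Equivalence.from (domain z _) (0 , N≥1 , refl))) N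

  module DiagonalFamily where
    fRunE diagRunE flagE : Expr
    fRunE = timedRunE (lit ef) candidateE timeE
    diagRunE = timedRunE (predE fRunE) (predE (siblingRunE eg)) timeE
    flagE = ifz fRunE (lit 0) (ifz (siblingRunE eg) (lit 0) (ifz diagRunE (lit 0) (ifEqE (var 0) (predE (siblingRunE eg)) (lit 1) (lit 0))))

    open SearchFamily flagE

    Diagonal : ℕ → Set
    Diagonal z = W Φ z (member z)

    fRun gRun diagRun : ℕ → ℕ
    fRun n = timedRun ef (proj₁ (unpair n)) (proj₂ (unpair n))
    gRun n = timedRun eg (code (proj₁ (unpair n)) selfDatum) (proj₂ (unpair n))
    diagRun n = timedRun (predℕ (fRun n)) (predℕ (gRun n)) (proj₂ (unpair n))

    flag : ℕ → ℕ → ℕ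
    flag y n = ifZero (fRun n) 0 (ifZero (gRun n) 0 (ifZero (diagRun n) 0 (if y ≡ᵇ predℕ (gRun n) then 1 else 0)))

    flagE-eval : ∀ y z n → evalAt flagE y z selfDatum n ≡ flag y n
    flagE-eval y z n =
      trans (cong (λ t → ifZero (⟦ fRunE ⟧ ρ) 0 (ifZero (⟦ siblingRunE eg ⟧ ρ) 0 (ifZero (⟦ diagRunE ⟧ ρ) 0 t)))
                  (ifEqE-eval (var 0) (predE (siblingRunE eg)) (lit 1) (lit 0) ρ))
            (cong₃ (λ a b c → ifZero a 0 (ifZero b 0 (ifZero c 0 (if y ≡ᵇ predℕ b then 1 else 0))))
                   fRun-eval (siblingRun-eval eg y z n) diagRun-eval)
      where
      ρ : ℕ → ℕ
      ρ = searchEnv y z selfDatum n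
      fRun-eval : ⟦ fRunE ⟧ ρ ≡ fRun n
      fRun-eval = trans (timedRunE-eval (lit ef) candidateE timeE ρ) (cong₂ (timedRun ef) (unpair₁E-eval (var 3) ρ) (unpair₂E-eval (var 3) ρ))
      diagRun-eval : ⟦ diagRunE ⟧ ρ ≡ diagRun n
      diagRun-eval = trans (timedRunE-eval (predE fRunE) (predE (siblingRunE eg)) timeE ρ)
        (cong₃ (λ a b c → timedRun (predℕ a) (predℕ b) c) fRun-eval (siblingRun-eval eg y z n) (unpair₂E-eval (var 3) ρ))

    flag-sound : ∀ y n m → flag y n ≡ suc m → Image member Diagonal y
    flag-sound y n m = accept (fRun n) refl (gRun n) refl (diagRun n) refl
      where
      z k : ℕ
      z = proj₁ (unpair n)
      k = proj₂ (unpair n)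
      accept : ∀ F → fRun n ≡ F → ∀ G → gRun n ≡ G → ∀ D → diagRun n ≡ D →
        ifZero F 0 (ifZero G 0 (ifZero D 0 (if y ≡ᵇ predℕ G then 1 else 0))) ≡ suc m → Image member Diagonal y
      accept (suc F) f≡ (suc G) g≡ (suc v) d≡ h = z , (v , φ) , trans (≡ᵇ≡true⇒≡ y G (if1else0≡suc⇒true h)) G≡
        where
        F≡ : F ≡ f z
        F≡ = Ψ₀-functional (timedRun⇒Ψ₀ {ef} {z} {F} {k} f≡) (proj₂ f-computable z)
        G≡ : G ≡ member z
        G≡ = timedRun-g {code z selfDatum} {G} {k} g≡
        ψ : Ψ₀ (f z) (member z) v
        ψ = subst₂ (λ e x → Ψ₀ e x v) F≡ G≡
              (timedRun⇒Ψ₀ {F} {G} {v} {k} (trans (cong₂ (λ a b → timedRun (predℕ a) (predℕ b) k) (sym f≡) (sym g≡)) d≡))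
        φ : Φ z (member z) v
        φ = Equivalence.from (toΨ₀ z (member z) v) ψ

    flag-complete : ∀ y → Image member Diagonal y → Σ ℕ λ n → Σ ℕ λ m → flag y n ≡ suc m
    flag-complete y (z , (v , φ) , refl) = pair z K , 0 , accepted
      where
      f-halts = Ψ₀⇒timedRun (proj₂ f-computable z)
      g-halts = Ψ₀⇒timedRun (proj₂ g-computable (code z selfDatum))
      diag-halts = Ψ₀⇒timedRun (Equivalence.to (toΨ₀ z (member z) v) φ)
      K : ℕ
      K = proj₁ f-halts + proj₁ g-halts + proj₁ diag-halts
      f≡ : timedRun ef z K ≡ suc (f z)
      f≡ = timedRun-mono {ef} {z} {f z} {proj₁ f-halts} {K} (proj₂ f-halts) (≤-trans (m≤m+n _ _) (m≤m+n _ (proj₁ diag-halts)))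
      g≡ : timedRun eg (code z selfDatum) K ≡ suc (member z)
      g≡ = timedRun-mono {eg} {code z selfDatum} {member z} {proj₁ g-halts} {K} (proj₂ g-halts) (≤-trans (m≤n+m _ (proj₁ f-halts)) (m≤m+n _ (proj₁ diag-halts)))
      d≡ : timedRun (f z) (member z) K ≡ suc v
      d≡ = timedRun-mono {f z} {member z} {v} {proj₁ diag-halts} {K} (proj₂ diag-halts) (m≤n+m _ (proj₁ f-halts + proj₁ g-halts))
      accepted : flag (member z) (pair z K) ≡ 1
      accepted rewrite unpair-pair z K | f≡ | g≡ | d≡ | ≡ᵇ-refl (member z) = refl

    domain : ∀ z y → W Φ (member z) y ⇔ Image member Diagonal y
    domain = member-domain flag flagE-eval flag-sound flag-complete

    member-computable : TotalComputable member
    member-computable = Eval.code 0 selfDatum , λ x → computes x (Ψ₀⇒timedRun (proj₂ g-computable (code x selfDatum)))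
      where
      runE : Expr
      runE = timedRunE (lit eg) (selfCodeE (var 0) (var 2)) (var 3)
      module Eval = Search (ifz runE (lit 0) (lit 1)) (predE runE)
      run-eval : ∀ x n → evalAt runE x 0 selfDatum n ≡ timedRun eg (code x selfDatum) n
      run-eval x n = trans (timedRunE-eval (lit eg) (selfCodeE (var 0) (var 2)) (var 3) ρ) (cong (λ c → timedRun eg c n) (selfCode-eval (var 0) (var 2) ρ refl))
        where
        ρ : ℕ → ℕ
        ρ = searchEnv x 0 selfDatum n
      halted-value : ∀ {c n m} → ifZero (timedRun eg c n) 0 1 ≡ suc m → predℕ (timedRun eg c n) ≡ g c
      halted-value {c} {n} h with timedRun eg c n in run≡
      ... | zero = ⊥-elim (0≢1+n h)
      ... | suc G = timedRun-g {c} {G} {n} run≡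
      computes : ∀ x → (Σ ℕ λ k → timedRun eg (code x selfDatum) k ≡ suc (member x)) → Ψ₀ (Eval.code 0 selfDatum) x (member x)
      computes x (k , halted) =
        let (y , ψ) = Eval.halts 0 selfDatum x (k , 0 , cong (λ d → ifZero d 0 1) (trans (run-eval x k) halted))
            (n , _ , flag≡ , y≡) = Eval.sound ψ
        in subst (Ψ₀ _ x) (trans y≡ (trans (cong predℕ (run-eval x n)) (halted-value {code x selfDatum} {n} (trans (cong (λ d → ifZero d 0 1) (sym (run-eval x n))) flag≡)))) ψ

    creativeSelfConstructing : Σ (ℕ → Set) λ A → SelfConstructing Φ A × Creative Φ A
    creativeSelfConstructing =
      Image member Diagonal , selfConstructing-image member domain (g 0 , diagonal₀) ,
      image-diagonal-creative member member-computable member-injective (member (g 0) , domain (g 0))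
      where
      diagonal₀ : Diagonal (g 0)
      diagonal₀ = Equivalence.from (W-g 0 _) (_ , Ψ₀-empty _)
      member-injective : Injective _≡_ _≡_ member
      member-injective = injective-ifOutputIsIndex {Φ} member member-output
        (λ z → member (g 0) , Equivalence.from (domain z _) (g 0 , diagonal₀ , refl))

  module ComplementSearch {χ : ℕ → ℕ} (χ-computable : TotalComputable χ) where
    eχ : ℕ
    eχ = proj₁ χ-computable

    χRunE flagE : Expr
    χRunE = timedRunE (lit eχ) (var 0) (var 3)
    flagE = ifz χRunE (lit 0) (ifEqE (predE χRunE) (lit 1) (lit 0) (lit 1))

    open SearchFamily flagE

    flag : ℕ → ℕ → ℕ
    flag y n = ifZero (timedRun eχ y n) 0 (if predℕ (timedRun eχ y n) ≡ᵇ 1 then 0 else 1)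

    flagE-eval : ∀ y z n → evalAt flagE y z selfDatum n ≡ flag y n
    flagE-eval y z n =
      trans (cong (ifZero (⟦ χRunE ⟧ ρ) 0) (ifEqE-eval (predE χRunE) (lit 1) (lit 0) (lit 1) ρ))
            (cong (λ d → ifZero d 0 (if predℕ d ≡ᵇ 1 then 0 else 1)) (timedRunE-eval (lit eχ) (var 0) (var 3) ρ))
      where
      ρ : ℕ → ℕ
      ρ = searchEnv y z selfDatum n

    flag-sound : ∀ y n m → flag y n ≡ suc m → χ y ≢ 1
    flag-sound y n m = reject (timedRun eχ y n) refl
      where
      reject : ∀ d → timedRun eχ y n ≡ d → ifZero d 0 (if predℕ d ≡ᵇ 1 then 0 else 1) ≡ suc m → χ y ≢ 1
      reject (suc G) run≡ h χy≡1 =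
        0≢1+n (subst (λ t → (if t ≡ᵇ 1 then 0 else 1) ≡ suc m)
                     (trans (Ψ₀-functional (timedRun⇒Ψ₀ {eχ} {y} {G} {n} run≡) (proj₂ χ-computable y)) χy≡1) h)

    flag-complete : ∀ y → χ y ≢ 1 → Σ ℕ λ n → Σ ℕ λ m → flag y n ≡ suc m
    flag-complete y χy≢1 with Ψ₀⇒timedRun (proj₂ χ-computable y)
    ... | k , halted = k , 0 ,
      trans (cong (λ d → ifZero d 0 (if predℕ d ≡ᵇ 1 then 0 else 1)) halted) (cong (λ b → if b then 0 else 1) (≢⇒Distinct (χ y) 1 χy≢1))

    rejector : ℕ
    rejector = member 0

    rejector-domain : ∀ y → W Φ rejector y ⇔ (χ y ≢ 1)
    rejector-domain = member-domain flag flagE-eval flag-sound flag-complete 0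

  computable⇒ce-complement : ∀ {C} → Computable C → Σ ℕ λ x → ∀ y → W Φ x y ⇔ (¬ C y)
  computable⇒ce-complement (χ , χ-computable , decides) = rejector , λ y → mk⇔
    (λ w c → Equivalence.to (rejector-domain y) w (Equivalence.to (decides y) c))
    (λ ¬c → Equivalence.from (rejector-domain y) (λ χy≡1 → ¬c (Equivalence.from (decides y) χy≡1)))
    where open ComplementSearch χ-computable

  creative⇒¬computable : ∀ {C} → Creative Φ C → ¬ Computable C
  creative⇒¬computable creative computable = creative⇒¬ce-complement creative (computable⇒ce-complement computable)

mainTheorem4 : (Φ : Numbering) → Acceptable Φ →
    ((n : ℕ) → 1 ≤ n → Σ (ℕ → Set) (λ A → SelfConstructing Φ A × HasCardinality A n))
    × Σ (ℕ → Set) (λ A → SelfConstructing Φ A × ¬ Computable A)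
    × Σ (ℕ → Set) (λ A → SelfConstructing Φ A × Creative Φ A)
mainTheorem4 Φ (_ , _ , f-computable , g-computable , toΨ₀ , fromΨ₀) =
  let (A , selfConstructing , creative) = DiagonalFamily.creativeSelfConstructing
  in FiniteFamily.selfConstructing , (A , selfConstructing , creative⇒¬computable creative) , (A , selfConstructing , creative)
  where open WithAcceptable Φ f-computable g-computable toΨ₀ fromΨ₀
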